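{- If $(t_i)_{i\in\mathbb{N}}$ is an infinite sequence of terms, then there is a sequence of terms $(s_i)$ in normal form which represents a linear order isomorphic to the one represented by $(t_i)$.
   Context: A term is a formal expression built as follows: the singleton $1$ is a term; if $t_0,t_1$ are terms then $t_0{}^\wedge t_1$ is a term (concatenation; associative, written without brackets); if $n\ge1$ and $t_0,\dots,t_{n-1}$ are terms then $\mathbb{Q}_n(t_0,\dots,t_{n-1})$ is a term (a shuffle). Each term $t$ denotes a linear order $L_t$: $L_1$ is a one-point order; $L_{t_0{}^\wedge t_1}$ is $L_{t_0}$ followed by $L_{t_1}$; and $L_{\mathbb{Q}_n(t_0,\dots,t_{n-1})}$ is obtained from $\mathbb{Q}_n$ — the countable dense linear order without endpoints whose points are partitioned into $n$ colours $C_0,\dots,C_{n-1}$ such that between any two points there is a point of each colour — by replacing each point $q$ of colour $C_i$ by a copy of $L_{t_i}$, ordering points inside one copy as in $L_{t_i}$ and points in different copies according to the order of $\mathbb{Q}_n$. A term is finite if it denotes a finite linear order, infinite otherwise. $\emptyset$ denotes the empty order; concatenation with $\emptyset$ means omitting it. Terms that differ only by associativity of concatenation or by a permutation of the arguments of a shuffle are regarded as equal. The linear order represented by a sequence $(s_i)$ of terms (indexed by a finite initial segment of $\mathbb{N}$ or by $\mathbb{N}$) is the concatenation of the $L_{s_i}$ in order of the index. Normal form (n.f.) for terms is defined inductively: (1) every finite term is in n.f.; (2) a term $\mathbb{Q}_m(t_0,\dots,t_{m-1})$ is in n.f. if all $t_i$ are in n.f. and, up to permuting its arguments, it is of neither of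 the forms (i) $\mathbb{Q}_{k+1}(u_0,\dots,u_{k-1},u_j)$ with $j<k$, (ii) $\mathbb{Q}_{k+1}(u_0,\dots,u_{k-1},\tau_0{}^\wedge\mathbb{Q}_l(u_0,\dots,u_{l-1}){}^\wedge\tau_1)$ with $k\le l$ and $\tau_0,\tau_1\in\{\emptyset,u_0,\dots,u_{l-1}\}$; (3) a concatenation $t_0{}^\wedge\cdots{}^\wedge t_{n-1}$ is in n.f. if all $t_i$ are in n.f. and there are no consecutive factors of the form $P{}^\wedge\tau{}^\wedge P$ with $P=\mathbb{Q}_k(u_0,\dots,u_{k-1})$ and $\tau\in\{\emptyset,u_0,\dots,u_{k-1}\}$ (with $\tau=\emptyset$ meaning two consecutive equal factors $P{}^\wedge P$). A possibly infinite sequence of terms $(s_i)$ is in normal form if: (1) each $s_i$ is in n.f.; (2) there are no consecutive entries $s_{i-1},s_i,s_{i+1}$ with $s_{i-1}=s_{i+1}=\mathbb{Q}_k(u_0,\dots,u_{k-1})$ and $s_i\in\{u_0,\dots,u_{k-1}\}$, and no consecutive entries $s_i=s_{i+1}$ that are shuffles; (3) whenever $s_j$ is finite, either $s_{j+1}$ is infinite, or $(s_i)$ is an infinite sequence and $s_k=1$ for all $k\ge j$. -}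

module Defs where

open import Level using (Level; 0ℓ) renaming (suc to lsuc)
open import Data.Nat as ℕ using (ℕ; zero; suc; _≤_; _<?_)
open import Data.Fin as Fin using (Fin; zero; suc; fromℕ<)
open import Data.List using (List; []; _∷_; _++_; length; lookup; take; [_])
open import Data.List.Relation.Unary.All using (All)
open import Data.List.Relation.Unary.Any using (Any)
open import Data.List.Relation.Binary.Pointwise using (Pointwise)
open import Data.List.Relation.Binary.Permutation.Propositional using (_↭_)
open import Data.Maybe using (Maybe; just; nothing)
open import Data.Product using (Σ; ∃; _×_; _,_)
open import Data.Sum using (_⊎_; inj₁; inj₂)
open import Data.Unit using (⊤; tt)
open import Data.Empty using (⊥)
open import Relation.Nullary using (¬_; yes; no)
open import Relation.Binary.PropositionalEquality using (_≡_)
open import Relation.Binary.Structures using (IsStrictTotalOrder)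

-- Terms (syntax).
--   one        : the singleton 1
--   a ⌢ b      : concatenation a^b
--   Q t ts     : the shuffle Q_{1+length ts}(t , ts...) ; a shuffle
--                always has at least one argument.

data Term : Set where
  one : Term
  _⌢_ : Term → Term → Term
  Q   : Term → List Term → Term

infixr 5 _⌢_

infix 4 _≈ₜ_
data _≈ₜ_ : Term → Term → Set where
  ≈-refl  : ∀ {a} → a ≈ₜ a
  ≈-sym   : ∀ {a b} → a ≈ₜ b → b ≈ₜ a
  ≈-trans : ∀ {a b c} → a ≈ₜ b → b ≈ₜ c → a ≈ₜ c
  ≈-assoc : ∀ {a b c} → (a ⌢ b) ⌢ c ≈ₜ a ⌢ (b ⌢ c)
  ≈-⌢     : ∀ {a a' b b'} → a ≈ₜ a' → b ≈ₜ b' → a ⌢ b ≈ₜ a' ⌢ b'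
  ≈-Q     : ∀ {t t' ts ts'} → Pointwise _≈ₜ_ (t ∷ ts) (t' ∷ ts') →
            Q t ts ≈ₜ Q t' ts'
  ≈-perm  : ∀ {t t' ts ts'} → (t ∷ ts) ↭ (t' ∷ ts') → Q t ts ≈ₜ Q t' ts'

Qsnoc : List Term → Term → Term
Qsnoc []       x = Q x []
Qsnoc (y ∷ ys) x = Q y (ys ++ [ x ])

_⌢?_ : Maybe Term → Term → Term
just a  ⌢? b = a ⌢ b
nothing ⌢? b = b

_?⌢_ : Term → Maybe Term → Term
a ?⌢ just b  = a ⌢ b
a ?⌢ nothing = a

-- an element of {∅, u_0, ..., u_{l-1}}
pick : (u : List Term) → Maybe (Fin (length u)) → Maybe Term
pick u (just j) = just (lookup u j)
pick u nothing  = nothing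

catL : Term → List Term → Term
catL x []       = x
catL x (y ∷ ys) = x ⌢ catL y ys

factors : Term → List Term
factors (a ⌢ b) = factors a ++ factors b
factors t       = t ∷ []

IsShuffle : Term → Set
IsShuffle s = Σ Term λ t → Σ (List Term) λ ts → s ≈ₜ Q t ts

-- Form (i):  Q_{k+1}(u_0,…,u_{k-1},u_j), j<k  (up to term equality)
FormI : Term → Set
FormI s = Σ (List Term) λ u → Σ (Fin (length u)) λ j → s ≈ₜ Qsnoc u (lookup u j)

-- Form (ii): Q_{k+1}(u_0,…,u_{k-1}, τ0 ^ Q_l(u_0,…,u_{l-1}) ^ τ1),
--            k ≤ l, τ0,τ1 ∈ {∅,u_0,…,u_{l-1}}   (u = u₀ ∷ us, l = length u)
FormII : Term → Set
FormII s =
  Σ Term λ u₀ → Σ (List Term) λ us → Σ ℕ λ k →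
  Σ (Maybe (Fin (length (u₀ ∷ us)))) λ τ₀ →
  Σ (Maybe (Fin (length (u₀ ∷ us)))) λ τ₁ →
  k ≤ length (u₀ ∷ us) ×
  s ≈ₜ Qsnoc (take k (u₀ ∷ us))
             ((pick (u₀ ∷ us) τ₀ ⌢? Q u₀ us) ?⌢ pick (u₀ ∷ us) τ₁)

-- A list of factors containing consecutive factors P ^ τ ^ P with
-- P = Q_k(u_0..u_{k-1}) and τ ∈ {∅, u_0, …, u_{k-1}}.
BadFactors : List Term → Set
BadFactors fs =
  Σ (List Term) λ xs → Σ (List Term) λ ys → Σ Term λ P → Σ Term λ P' →
  Σ (List Term) λ mid → Σ Term λ t → Σ (List Term) λ ts →
  (fs ≡ xs ++ (P ∷ mid ++ (P' ∷ ys))) ×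
  P ≈ₜ Q t ts × P' ≈ₜ Q t ts ×
  (mid ≡ [] ⊎ Σ Term λ m → Σ (List Term) λ ms →
               mid ≡ m ∷ ms × Any (catL m ms ≈ₜ_) (t ∷ ts))

record LO : Set₁ where
  field
    Car : Set
    _<_ : Car → Car → Set

open LO

record _≅_ (A B : LO) : Set where
  field
    to      : Car A → Car B
    from    : Car B → Car A
    from-to : ∀ x → from (to x) ≡ x
    to-from : ∀ y → to (from y) ≡ y
    mono    : ∀ {x y} → _<_ A x y → _<_ B (to x) (to y)
    refl<   : ∀ {x y} → _<_ B (to x) (to y) → _<_ A x y

oneLO : LO
oneLO = record { Car = ⊤ ; _<_ = λ _ _ → ⊥ }

sum< : (A B : LO) → Car A ⊎ Car B → Car A ⊎ Car B → Set
sum< A B (inj₁ x) (inj₁ y) = _<_ A x y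
sum< A B (inj₁ x) (inj₂ y) = ⊤
sum< A B (inj₂ x) (inj₁ y) = ⊥
sum< A B (inj₂ x) (inj₂ y) = _<_ B x y

sumLO : LO → LO → LO
sumLO A B = record { Car = Car A ⊎ Car B ; _<_ = sum< A B }

data Lex {I : Set} (_<I_ : I → I → Set) (F : I → LO) :
         Σ I (λ i → Car (F i)) → Σ I (λ i → Car (F i)) → Set where
  fst< : ∀ {i j x y} → i <I j → Lex _<I_ F (i , x) (j , y)
  snd< : ∀ {i x y} → _<_ (F i) x y → Lex _<I_ F (i , x) (i , y)

ΣLO : (I : Set) → (I → I → Set) → (I → LO) → LO
ΣLO I _<I_ F = record { Car = Σ I (λ i → Car (F i)) ; _<_ = Lex _<I_ F }

FinLO : ℕ → LO
FinLO m = record { Car = Fin m ; _<_ = Fin._<_ }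

-- Q_n : a countable dense linear order without endpoints, partitioned
-- into n colours, each colour dense.  (Unique up to isomorphism.)

record DenseColoured (n : ℕ) : Set₁ where
  field
    Car       : Set
    _<_       : Car → Car → Set
    isSTO     : IsStrictTotalOrder _≡_ _<_
    colour    : Car → Fin n
    point     : Car
    enum      : ℕ → Car
    enum-surj : ∀ x → Σ ℕ λ k → enum k ≡ x
    noMin     : ∀ x → Σ Car λ y → y < x
    noMax     : ∀ x → Σ Car λ y → x < y
    denseCol  : ∀ {x y} → x < y → ∀ (i : Fin n) →
                Σ Car λ z → x < z × z < y × colour z ≡ i

data Seq : Set where
  finSeq : (m : ℕ) → (Fin m → Term) → Seq
  infSeq : (ℕ → Term) → Seq

entry : Seq → ℕ → Maybe Term
entry (finSeq m f) i with i <? m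
... | yes i<m = just (f (fromℕ< i<m))
... | no  _   = nothing
entry (infSeq g) i = just (g i)

IsInfSeq : Seq → Set
IsInfSeq (finSeq _ _) = ⊥
IsInfSeq (infSeq _)   = ⊤

module Semantics (Qs : (n : ℕ) → DenseColoured (suc n)) where

  QLO : ℕ → LO
  QLO n = record { Car = DenseColoured.Car (Qs n) ; _<_ = DenseColoured._<_ (Qs n) }

  mutual
    ⟦_⟧ : Term → LO
    ⟦ one ⟧    = oneLO
    ⟦ a ⌢ b ⟧  = sumLO ⟦ a ⟧ ⟦ b ⟧
    ⟦ Q t ts ⟧ = ΣLO (DenseColoured.Car (Qs (length ts)))
                     (DenseColoured._<_ (Qs (length ts)))
                     (λ q → arg t ts (DenseColoured.colour (Qs (length ts)) q))

    arg : Term → (ts : List Term) → Fin (suc (length ts)) → LO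
    arg t ts       zero    = ⟦ t ⟧
    arg t (u ∷ us) (suc i) = arg u us i

  seqLO : Seq → LO
  seqLO (finSeq m f) = ΣLO (Fin m) Fin._<_ (λ i → ⟦ f i ⟧)
  seqLO (infSeq g)   = ΣLO ℕ ℕ._<_ (λ i → ⟦ g i ⟧)

  Finite : Term → Set
  Finite t = Σ ℕ λ m → ⟦ t ⟧ ≅ FinLO m

  Infinite : Term → Set
  Infinite t = ¬ Finite t

  data NF : Term → Set where
    nf-fin : ∀ {t} → Finite t → NF t
    nf-Q   : ∀ {t ts} → All NF (t ∷ ts) →
             ¬ FormI (Q t ts) → ¬ FormII (Q t ts) → NF (Q t ts)
    nf-⌢   : ∀ {a b} → All NF (factors (a ⌢ b)) →
             ¬ BadFactors (factors (a ⌢ b)) → NF (a ⌢ b)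

  record SeqNF (S : Seq) : Set where
    field
      entriesNF : ∀ i s → entry S i ≡ just s → NF s
      noPτP     : ∀ i a b c → entry S i ≡ just a → entry S (suc i) ≡ just b →
                  entry S (suc (suc i)) ≡ just c →
                  ¬ (Σ Term λ t → Σ (List Term) λ ts →
                       a ≈ₜ Q t ts × c ≈ₜ Q t ts × Any (b ≈ₜ_) (t ∷ ts))
      noPP      : ∀ i a b → entry S i ≡ just a → entry S (suc i) ≡ just b →
                  ¬ (IsShuffle a × a ≈ₜ b)
      finite    : ∀ j a → entry S j ≡ just a → Finite a →
                  (Σ Term λ b → entry S (suc j) ≡ just b × Infinite b)
                  ⊎ (IsInfSeq S ×
                     (∀ k → j ≤ k → Σ Term λ b → entry S k ≡ just b × b ≈ₜ one))

-- Each term denotes an ordered sum of letters: copies of 1 and shuffles in normal form. By a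
-- back-and-forth argument any two countable dense orders without endpoints, coloured so that every
-- colour is dense, are isomorphic; sums of points and such dense pieces in which no point is extremal
-- and no two points are adjacent are again of this kind. This shows that forms (i) and (ii), P ⌢ P,
-- P ⌢ τ ⌢ P and ω copies of P all denote the shuffle P, so normalising the arguments of a shuffle and
-- collapsing forms (i) and (ii) (which lowers the size) normalises a shuffle, and removing bad
-- factors normalises a concatenation. Flattening the input sequence gives a stream of letters. If
-- only finitely many letters are shuffles, the sequence is one term up to the last shuffle followed by
-- 1, 1, ...; if the letters are eventually copies of one shuffle, a single term suffices; otherwise
-- the stream is cut into blocks, each concatenating to an infinite term that is not a shuffle, and
-- the sequence conditions hold trivially. Excluded middle decides the cases and normality of terms.

module Submission where

open import Defs
open import Data.Nat as ℕ using (ℕ; zero; suc; _+_; _∸_; _≤_; _<_; z≤n; s≤s; _<?_)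
import Data.Nat.Properties as ℕ
open import Data.Fin as Fin using (Fin; zero; suc; toℕ; fromℕ<)
import Data.Fin.Properties as Fin
open import Data.List using (List; []; _∷_; _++_; [_]; length; lookup; take; map)
open import Data.List.Relation.Unary.All as All using (All; []; _∷_)
open import Data.List.Relation.Unary.Any as Any using (Any; here; there)
open import Data.List.Relation.Unary.All.Properties using (++⁺; ++⁻; ++⁻ʳ)
open import Data.List.Relation.Unary.Any.Properties using (lookup-index; ++⁺ʳ)
open import Data.List.Properties using (length-++-≤ʳ)
open import Data.List.Membership.Propositional using (_∈_)
open import Data.List.Membership.Propositional.Properties using (∈-map⁺; ∈-map⁻; ∈-++⁺ʳ; ∈-lookup)
open import Data.Maybe as Maybe using (Maybe; just; nothing)
open import Data.Product using (Σ; _×_; _,_; proj₁; proj₂; swap)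
open import Function using (_∘_)
open import Data.Sum as Sum using (_⊎_; inj₁; inj₂)
open import Data.Unit using (⊤; tt)
open import Data.Empty using (⊥; ⊥-elim)
open import Relation.Nullary using (¬_; Dec; yes; no)
open import Relation.Binary.Definitions using (Tri; tri<; tri≈; tri>)
open import Relation.Binary.PropositionalEquality
  using (_≡_; refl; sym; trans; cong; cong₂; subst; subst₂; setoid)
open import Relation.Binary.Structures using (IsStrictTotalOrder)
open import Data.List.Relation.Binary.Pointwise using (Pointwise; []; _∷_; Pointwise-length)
import Data.List.Relation.Binary.Pointwise.Properties as Pointwise
open import Data.List.Relation.Binary.Permutation.Propositional as ↭ using (_↭_; ↭⇒↭ₛ)
import Data.List.Relation.Binary.Permutation.Setoid.Properties as ↭ₛ
open import Data.List.Relation.Binary.Permutation.Homogeneous using (onIndices)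
open import Data.Fin.Permutation using (_⟨$⟩ʳ_; _⟨$⟩ˡ_; inverseʳ)
open import Algebra.Properties.CommutativeSemigroup ℕ.+-commutativeSemigroup using (x∙yz≈y∙xz)
open import Axiom.ExcludedMiddle using (ExcludedMiddle)

open LO using (Car)
open _≅_

least : ∀ {P : ℕ → Set} → (∀ n → Dec (P n)) → ∀ {n} → P n →
        Σ ℕ λ i → P i × (∀ m → m < i → ¬ P m)
least {P} P? {n} Pn = search n 0 (ℕ.+-identityʳ n) (λ _ ())
  where
  search : ∀ d k → d + k ≡ n → (∀ m → m < k → ¬ P m) → Σ ℕ λ i → P i × (∀ m → m < i → ¬ P m)
  search d k _ below with P? k
  ... | yes Pk = k , Pk , below
  search zero k refl below | no ¬Pk = ⊥-elim (¬Pk Pn)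
  search (suc d) k e below | no ¬Pk = search d (suc k) (trans (ℕ.+-suc d k) e) below'
    where
    below' : ∀ m → m < suc k → ¬ P m
    below' m m<sk with ℕ.m≤n⇒m<n∨m≡n (ℕ.≤-pred m<sk)
    ... | inj₁ m<k = below m m<k
    ... | inj₂ refl = ¬Pk

cast-surj : ∀ {m n} (e : m ≡ n) j → Σ (Fin m) λ i → Fin.cast e i ≡ j
cast-surj e j = Fin.cast (sym e) j , Fin.cast-involutive e (sym e) j

-- Isomorphisms of linear orders and ordered sums

≅-refl : ∀ {A} → A ≅ A
≅-refl = record
  { to = λ x → x ; from = λ x → x ; from-to = λ _ → refl ; to-from = λ _ → refl
  ; mono = λ p → p ; refl< = λ p → p }

≅-sym : ∀ {A B} → A ≅ B → B ≅ A
≅-sym {A} {B} f = record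
  { to = from f ; from = to f ; from-to = to-from f ; to-from = from-to f
  ; mono = λ {x} {y} p → refl< f (subst₂ (LO._<_ B) (sym (to-from f x)) (sym (to-from f y)) p)
  ; refl< = λ {x} {y} p → subst₂ (LO._<_ B) (to-from f x) (to-from f y) (mono f p) }

≅-trans : ∀ {A B C} → A ≅ B → B ≅ C → A ≅ C
≅-trans f g = record
  { to = λ x → to g (to f x) ; from = λ z → from f (from g z)
  ; from-to = λ x → trans (cong (from f) (from-to g (to f x))) (from-to f x)
  ; to-from = λ z → trans (cong (to g) (to-from f (from g z))) (to-from g z)
  ; mono = λ p → mono g (mono f p) ; refl< = λ p → refl< f (refl< g p) }

≡⇒≅ : ∀ {A B} → A ≡ B → A ≅ B
≡⇒≅ refl = ≅-refl

module ≅-Reasoning where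
  infix  1 begin_
  infixr 2 _≅⟨_⟩_ _≅⟨_⟨_ _≡⟨_⟩_
  infix  3 _∎

  begin_ : ∀ {A B} → A ≅ B → A ≅ B
  begin p = p

  _≅⟨_⟩_ : ∀ A {B C} → A ≅ B → B ≅ C → A ≅ C
  _ ≅⟨ p ⟩ q = ≅-trans p q

  _≅⟨_⟨_ : ∀ A {B C} → B ≅ A → B ≅ C → A ≅ C
  _ ≅⟨ p ⟨ q = ≅-trans (≅-sym p) q

  _≡⟨_⟩_ : ∀ A {B C} → A ≡ B → B ≅ C → A ≅ C
  _ ≡⟨ p ⟩ q = ≅-trans (≡⇒≅ p) q

  _∎ : ∀ A → A ≅ A
  _ ∎ = ≅-refl

open ≅-Reasoning

emptyLO : LO
emptyLO = record { Car = ⊥ ; _<_ = λ _ _ → ⊥ }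

sumLO-cong : ∀ {A A' B B'} → A ≅ A' → B ≅ B' → sumLO A B ≅ sumLO A' B'
sumLO-cong {A} {A'} {B} {B'} f g = record
  { to = Sum.map (to f) (to g) ; from = Sum.map (from f) (from g)
  ; from-to = λ { (inj₁ x) → cong inj₁ (from-to f x) ; (inj₂ x) → cong inj₂ (from-to g x) }
  ; to-from = λ { (inj₁ x) → cong inj₁ (to-from f x) ; (inj₂ x) → cong inj₂ (to-from g x) }
  ; mono = λ {x} {y} → mono' {x} {y} ; refl< = λ {x} {y} → refl<' {x} {y} }
  where
  mono' : ∀ {x y} → sum< A B x y → sum< A' B' (Sum.map (to f) (to g) x) (Sum.map (to f) (to g) y)
  mono' {inj₁ _} {inj₁ _} p = mono f p
  mono' {inj₁ _} {inj₂ _} p = tt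
  mono' {inj₂ _} {inj₂ _} p = mono g p
  refl<' : ∀ {x y} → sum< A' B' (Sum.map (to f) (to g) x) (Sum.map (to f) (to g) y) → sum< A B x y
  refl<' {inj₁ _} {inj₁ _} p = refl< f p
  refl<' {inj₁ _} {inj₂ _} p = tt
  refl<' {inj₂ _} {inj₂ _} p = refl< g p

sumLO-assoc : ∀ {A B C} → sumLO (sumLO A B) C ≅ sumLO A (sumLO B C)
sumLO-assoc {A} {B} {C} = record
  { to = Sum.assocʳ ; from = Sum.assocˡ
  ; from-to = λ { (inj₁ (inj₁ _)) → refl ; (inj₁ (inj₂ _)) → refl ; (inj₂ _) → refl }
  ; to-from = λ { (inj₁ _) → refl ; (inj₂ (inj₁ _)) → refl ; (inj₂ (inj₂ _)) → refl }
  ; mono = λ {x} {y} → mono' {x} {y} ; refl< = λ {x} {y} → refl<' {x} {y} }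
  where
  mono' : ∀ {x y} → LO._<_ (sumLO (sumLO A B) C) x y →
          LO._<_ (sumLO A (sumLO B C)) (Sum.assocʳ x) (Sum.assocʳ y)
  mono' {inj₁ (inj₁ _)} {inj₁ (inj₁ _)} p = p
  mono' {inj₁ (inj₁ _)} {inj₁ (inj₂ _)} p = tt
  mono' {inj₁ (inj₁ _)} {inj₂ _}        p = tt
  mono' {inj₁ (inj₂ _)} {inj₁ (inj₂ _)} p = p
  mono' {inj₁ (inj₂ _)} {inj₂ _}        p = tt
  mono' {inj₂ _}        {inj₂ _}        p = p
  refl<' : ∀ {x y} → LO._<_ (sumLO A (sumLO B C)) (Sum.assocʳ x) (Sum.assocʳ y) →
           LO._<_ (sumLO (sumLO A B) C) x y
  refl<' {inj₁ (inj₁ _)} {inj₁ (inj₁ _)} p = p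
  refl<' {inj₁ (inj₁ _)} {inj₁ (inj₂ _)} p = tt
  refl<' {inj₁ (inj₁ _)} {inj₂ _}        p = tt
  refl<' {inj₁ (inj₂ _)} {inj₁ (inj₂ _)} p = p
  refl<' {inj₁ (inj₂ _)} {inj₂ _}        p = tt
  refl<' {inj₂ _}        {inj₂ _}        p = p
  refl<' {inj₁ (inj₂ _)} {inj₁ (inj₁ _)} ()
  refl<' {inj₂ _}        {inj₁ (inj₁ _)} ()
  refl<' {inj₂ _}        {inj₁ (inj₂ _)} ()

sumLO-identityˡ : ∀ A → sumLO emptyLO A ≅ A
sumLO-identityˡ A = record
  { to = λ { (inj₂ x) → x } ; from = inj₂ ; from-to = λ { (inj₂ _) → refl } ; to-from = λ _ → refl
  ; mono = λ { {inj₂ _} {inj₂ _} p → p } ; refl< = λ { {inj₂ _} {inj₂ _} p → p } }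

sumLO-identityʳ : ∀ A → sumLO A emptyLO ≅ A
sumLO-identityʳ A = record
  { to = λ { (inj₁ x) → x } ; from = inj₁ ; from-to = λ { (inj₁ _) → refl } ; to-from = λ _ → refl
  ; mono = λ { {inj₁ _} {inj₁ _} p → p } ; refl< = λ { {inj₁ _} {inj₁ _} p → p } }

module _ {I : Set} {_<I_ : I → I → Set} {F : I → LO} where

  Lex-view : ∀ {p q} → Lex _<I_ F p q →
             proj₁ p <I proj₁ q ⊎
             Σ (proj₁ p ≡ proj₁ q) λ e →
               LO._<_ (F (proj₁ q)) (subst (λ i → Car (F i)) e (proj₂ p)) (proj₂ q)
  Lex-view (fst< r) = inj₁ r
  Lex-view (snd< q) = inj₂ (refl , q)

  ΣLO-congʳ : ∀ {G : I → LO} → (∀ i → F i ≅ G i) → ΣLO I _<I_ F ≅ ΣLO I _<I_ G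
  ΣLO-congʳ {G} h = record
    { to = λ { (i , x) → i , to (h i) x } ; from = λ { (i , x) → i , from (h i) x }
    ; from-to = λ { (i , x) → cong (i ,_) (from-to (h i) x) }
    ; to-from = λ { (i , x) → cong (i ,_) (to-from (h i) x) }
    ; mono = λ { (fst< r) → fst< r ; (snd< {i} q) → snd< (mono (h i) q) }
    ; refl< = refl<' }
    where
    refl<' : ∀ {x y} → Lex _<I_ G (proj₁ x , to (h (proj₁ x)) (proj₂ x))
                                  (proj₁ y , to (h (proj₁ y)) (proj₂ y)) →
             Lex _<I_ F x y
    refl<' {i , _} {j , _} (fst< r) = fst< r
    refl<' {i , _} {.i , _} (snd< q) = snd< (refl< (h i) q)

ΣLO-reindex : ∀ {I J : Set} {R : I → I → Set} {S : J → J → Set} {G : J → LO} →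
              (φ : record { Car = I ; _<_ = R } ≅ record { Car = J ; _<_ = S }) →
              ΣLO I R (λ i → G (to φ i)) ≅ ΣLO J S G
ΣLO-reindex {I} {J} {R} {S} {G} φ = record
  { to = λ { (i , x) → to φ i , x } ; from = from' ; from-to = from-to' ; to-from = to-from'
  ; mono = λ { (fst< r) → fst< (mono φ r) ; (snd< q) → snd< q } ; refl< = refl<' }
  where
  transport : ∀ {j k} → j ≡ k → Car (G j) → Car (G k)
  transport e = subst (λ k → Car (G k)) e
  from' : Σ J (λ j → Car (G j)) → Σ I (λ i → Car (G (to φ i)))
  from' (j , y) = from φ j , transport (sym (to-from φ j)) y
  pair-≡ : ∀ {j k} (e : j ≡ k) (y : Car (G k)) → (j , transport (sym e) y) ≡ (k , y)
  pair-≡ refl y = refl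
  to-from' : ∀ p → (to φ (proj₁ (from' p)) , proj₂ (from' p)) ≡ p
  to-from' (j , y) = pair-≡ (to-from φ j) y
  from-to' : ∀ p → from' (to φ (proj₁ p) , proj₂ p) ≡ p
  from-to' (i , x) = lemma (from-to φ i) (to-from φ (to φ i))
    where
    lemma : ∀ {i'} → i' ≡ i → (e : to φ i' ≡ to φ i) → (i' , transport (sym e) x) ≡ (i , x)
    lemma refl refl = refl
  to-injective : ∀ {i i'} → to φ i ≡ to φ i' → i ≡ i'
  to-injective {i} {i'} e = trans (sym (from-to φ i)) (trans (cong (from φ) e) (from-to φ i'))
  refl<' : ∀ {x y} → Lex S G (to φ (proj₁ x) , proj₂ x) (to φ (proj₁ y) , proj₂ y) →
           Lex R (λ i → G (to φ i)) x y
  refl<' {i , x} {i' , y} l with Lex-view l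
  ... | inj₁ r = fst< (refl< φ r)
  ... | inj₂ (e , q) = snd<-from (to-injective e) e q
    where
    snd<-from : (e : i ≡ i') (e' : to φ i ≡ to φ i') → LO._<_ (G (to φ i')) (transport e' x) y →
                Lex R (λ i → G (to φ i)) (i , x) (i' , y)
    snd<-from refl refl q = snd< q

ΣLO-assoc : ∀ {I : Set} {R : I → I → Set} {J : I → Set} {S : ∀ i → J i → J i → Set}
              {G : ∀ i → J i → LO} →
            ΣLO I R (λ i → ΣLO (J i) (S i) (G i)) ≅
            ΣLO (Σ I J) (Lex R (λ i → record { Car = J i ; _<_ = S i })) (λ p → G (proj₁ p) (proj₂ p))
ΣLO-assoc {I} {R} {J} {S} {G} = record
  { to = λ { (i , j , x) → (i , j) , x } ; from = λ { ((i , j) , x) → i , j , x }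
  ; from-to = λ _ → refl ; to-from = λ _ → refl
  ; mono = λ { (fst< r) → fst< (fst< r) ; (snd< (fst< s)) → fst< (snd< s) ; (snd< (snd< q)) → snd< q }
  ; refl< = refl<' }
  where
  refl<' : ∀ {i j x i' j' y} →
           Lex (Lex R (λ i → record { Car = J i ; _<_ = S i })) (λ p → G (proj₁ p) (proj₂ p))
               ((i , j) , x) ((i' , j') , y) →
           Lex R (λ i → ΣLO (J i) (S i) (G i)) (i , j , x) (i' , j' , y)
  refl<' l with Lex-view l
  ... | inj₂ (refl , q) = snd< (snd< q)
  ... | inj₁ l' with Lex-view l'
  ...   | inj₁ r = fst< r
  ...   | inj₂ (refl , s) = snd< (fst< s)

ΣLO-unit : ∀ A → ΣLO ⊤ (λ _ _ → ⊥) (λ _ → A) ≅ A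
ΣLO-unit A = record
  { to = proj₂ ; from = tt ,_ ; from-to = λ _ → refl ; to-from = λ _ → refl
  ; mono = λ { (snd< q) → q } ; refl< = snd< }

ΣLO-Fin1 : ∀ (G : Fin 1 → LO) → ΣLO (Fin 1) Fin._<_ G ≅ G zero
ΣLO-Fin1 G = record
  { to = λ { (zero , x) → x } ; from = zero ,_ ; from-to = λ { (zero , _) → refl } ; to-from = λ _ → refl
  ; mono = λ { {zero , _} {zero , _} (snd< q) → q } ; refl< = λ { {zero , _} {zero , _} q → snd< q } }

ΣLO-Fin-suc : ∀ n (G : Fin (suc (suc n)) → LO) →
              ΣLO (Fin (suc (suc n))) Fin._<_ G ≅ sumLO (G zero) (ΣLO (Fin (suc n)) Fin._<_ (λ k → G (suc k)))
ΣLO-Fin-suc n G = record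
  { to = to' ; from = λ { (inj₁ x) → zero , x ; (inj₂ (i , x)) → suc i , x }
  ; from-to = λ { (zero , _) → refl ; (suc _ , _) → refl } ; to-from = λ { (inj₁ _) → refl ; (inj₂ _) → refl }
  ; mono = λ {x} {y} → mono' {x} {y} ; refl< = λ {x} {y} → refl<' {x} {y} }
  where
  Tail = ΣLO (Fin (suc n)) Fin._<_ (λ k → G (suc k))
  to' : Σ (Fin (suc (suc n))) (λ i → Car (G i)) → Car (G zero) ⊎ Car Tail
  to' (zero , x) = inj₁ x
  to' (suc i , x) = inj₂ (i , x)
  mono' : ∀ {x y} → Lex Fin._<_ G x y → sum< (G zero) Tail (to' x) (to' y)
  mono' {zero , _} {zero , _} (snd< q) = q
  mono' {zero , _} {suc _ , _} _ = tt
  mono' {suc _ , _} {suc _ , _} (fst< (s≤s r)) = fst< r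
  mono' {suc _ , _} {suc _ , _} (snd< q) = snd< q
  refl<' : ∀ {x y} → sum< (G zero) Tail (to' x) (to' y) → Lex Fin._<_ G x y
  refl<' {zero , _} {zero , _} q = snd< q
  refl<' {zero , _} {suc _ , _} _ = fst< (s≤s z≤n)
  refl<' {suc _ , _} {suc _ , _} (fst< r) = fst< (s≤s r)
  refl<' {suc _ , _} {suc _ , _} (snd< q) = snd< q

ΣLO-Fin2 : ∀ (G : Fin 2 → LO) → ΣLO (Fin 2) Fin._<_ G ≅ sumLO (G zero) (G (suc zero))
ΣLO-Fin2 G = ≅-trans (ΣLO-Fin-suc 0 G) (sumLO-cong ≅-refl (ΣLO-Fin1 _))

ΣLO-Fin3 : ∀ (G : Fin 3 → LO) → ΣLO (Fin 3) Fin._<_ G ≅ sumLO (G zero) (sumLO (G (suc zero)) (G (suc (suc zero))))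
ΣLO-Fin3 G = ≅-trans (ΣLO-Fin-suc 1 G) (sumLO-cong ≅-refl (ΣLO-Fin2 _))

ΣLO-ℕ-suc : ∀ (G : ℕ → LO) → ΣLO ℕ _<_ G ≅ sumLO (G 0) (ΣLO ℕ _<_ (λ n → G (suc n)))
ΣLO-ℕ-suc G = record
  { to = to' ; from = λ { (inj₁ x) → zero , x ; (inj₂ (i , x)) → suc i , x }
  ; from-to = λ { (zero , _) → refl ; (suc _ , _) → refl } ; to-from = λ { (inj₁ _) → refl ; (inj₂ _) → refl }
  ; mono = λ {x} {y} → mono' {x} {y} ; refl< = λ {x} {y} → refl<' {x} {y} }
  where
  Tail = ΣLO ℕ _<_ (λ n → G (suc n))
  to' : Σ ℕ (λ i → Car (G i)) → Car (G 0) ⊎ Car Tail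
  to' (zero , x) = inj₁ x
  to' (suc i , x) = inj₂ (i , x)
  mono' : ∀ {x y} → Lex _<_ G x y → sum< (G 0) Tail (to' x) (to' y)
  mono' {zero , _} {zero , _} (snd< q) = q
  mono' {zero , _} {suc _ , _} _ = tt
  mono' {suc _ , _} {suc _ , _} (fst< (s≤s r)) = fst< r
  mono' {suc _ , _} {suc _ , _} (snd< q) = snd< q
  refl<' : ∀ {x y} → sum< (G 0) Tail (to' x) (to' y) → Lex _<_ G x y
  refl<' {zero , _} {zero , _} q = snd< q
  refl<' {zero , _} {suc _ , _} _ = fst< (s≤s z≤n)
  refl<' {suc _ , _} {suc _ , _} (fst< r) = fst< (s≤s r)
  refl<' {suc _ , _} {suc _ , _} (snd< q) = snd< q

blockLO : (ℕ → LO) → ℕ → ℕ → LO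
blockLO F s l = ΣLO (Fin (suc l)) Fin._<_ (λ k → F (s + toℕ k))

blockLO-zero : ∀ F s → blockLO F s 0 ≅ F s
blockLO-zero F s = ≅-trans (ΣLO-Fin1 _) (≡⇒≅ (cong F (ℕ.+-identityʳ s)))

blockLO-suc : ∀ F s l → blockLO F s (suc l) ≅ sumLO (F s) (blockLO F (suc s) l)
blockLO-suc F s l =
  ≅-trans (ΣLO-Fin-suc l _)
          (sumLO-cong (≡⇒≅ (cong F (ℕ.+-identityʳ s))) (ΣLO-congʳ (λ k → ≡⇒≅ (cong F (ℕ.+-suc s (toℕ k))))))

blockLO-snoc : ∀ F s l → blockLO F s (suc l) ≅ sumLO (blockLO F s l) (F (s + suc l))
blockLO-snoc F s zero = begin
  blockLO F s 1                              ≅⟨ blockLO-suc F s 0 ⟩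
  sumLO (F s) (blockLO F (suc s) 0)          ≅⟨ sumLO-cong ≅-refl (blockLO-zero F (suc s)) ⟩
  sumLO (F s) (F (suc s))                    ≡⟨ cong (λ n → sumLO (F s) (F n)) (ℕ.+-comm 1 s) ⟩
  sumLO (F s) (F (s + 1))                    ≅⟨ sumLO-cong (blockLO-zero F s) ≅-refl ⟨
  sumLO (blockLO F s 0) (F (s + 1))          ∎
blockLO-snoc F s (suc l) = begin
  blockLO F s (suc (suc l))                                       ≅⟨ blockLO-suc F s (suc l) ⟩
  sumLO (F s) (blockLO F (suc s) (suc l))                         ≅⟨ sumLO-cong ≅-refl (blockLO-snoc F (suc s) l) ⟩
  sumLO (F s) (sumLO (blockLO F (suc s) l) (F (suc s + suc l)))   ≅⟨ sumLO-assoc ⟨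
  sumLO (sumLO (F s) (blockLO F (suc s) l)) (F (suc s + suc l))   ≅⟨ sumLO-cong (blockLO-suc F s l) ≅-refl ⟨
  sumLO (blockLO F s (suc l)) (F (suc s + suc l))                 ≡⟨ cong (sumLO (blockLO F s (suc l)) ∘ F) (sym s+sl≡) ⟩
  sumLO (blockLO F s (suc l)) (F (s + suc (suc l)))               ∎
  where s+sl≡ = ℕ.+-suc s (suc l)

ΣLO-ℕ-split : ∀ (F : ℕ → LO) c → ΣLO ℕ _<_ F ≅ sumLO (blockLO F 0 c) (ΣLO ℕ _<_ (λ n → F (suc c + n)))
ΣLO-ℕ-split F zero = ≅-trans (ΣLO-ℕ-suc F) (sumLO-cong (≅-sym (blockLO-zero F 0)) ≅-refl)
ΣLO-ℕ-split F (suc c) = begin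
  ΣLO ℕ _<_ F                                            ≅⟨ ΣLO-ℕ-suc F ⟩
  sumLO (F 0) (ΣLO ℕ _<_ (λ n → F (suc n)))              ≅⟨ sumLO-cong ≅-refl (ΣLO-ℕ-split (F ∘ suc) c) ⟩
  sumLO (F 0) (sumLO (blockLO F 1 c) Tail)               ≅⟨ sumLO-assoc ⟨
  sumLO (sumLO (F 0) (blockLO F 1 c)) Tail               ≅⟨ sumLO-cong (blockLO-suc F 0 c) ≅-refl ⟨
  sumLO (blockLO F 0 (suc c)) Tail                       ∎
  where Tail = ΣLO ℕ _<_ (λ n → F (suc (suc c) + n))

AscendingChain : LO → Set
AscendingChain X = Σ (ℕ → Car X) λ x → ∀ n → LO._<_ X (x n) (x (suc n))

AscendingChain-≅ : ∀ {X Y} → X ≅ Y → AscendingChain X → AscendingChain Y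
AscendingChain-≅ φ (x , x<) = (λ n → to φ (x n)) , λ n → mono φ (x< n)

AscendingChain-sumLOˡ : ∀ {X Y} → AscendingChain X → AscendingChain (sumLO X Y)
AscendingChain-sumLOˡ (x , x<) = (λ n → inj₁ (x n)) , x<

AscendingChain-sumLOʳ : ∀ {X Y} → AscendingChain Y → AscendingChain (sumLO X Y)
AscendingChain-sumLOʳ (y , y<) = (λ n → inj₂ (y n)) , y<

AscendingChain⇒¬finite : ∀ {X} → AscendingChain X → ∀ m → ¬ X ≅ FinLO m
AscendingChain⇒¬finite (x , x<) m φ = ℕ.<-irrefl refl (ℕ.<-≤-trans (Fin.toℕ<n (to φ (x m))) (grows m))
  where
  grows : ∀ n → n ≤ toℕ (to φ (x n))
  grows zero = z≤n
  grows (suc n) = ℕ.≤-<-trans (grows n) (mono φ (x< n))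

-- Countable linear orders

record CountableOrder : Set₁ where
  field
    Carrier    : Set
    _≺_        : Carrier → Carrier → Set
    irrefl     : ∀ {x} → ¬ x ≺ x
    ≺-trans    : ∀ {x y z} → x ≺ y → y ≺ z → x ≺ z
    trichotomy : ∀ x y → x ≺ y ⊎ x ≡ y ⊎ y ≺ x
    enum       : ℕ → Carrier
    enum-surj  : ∀ x → Σ ℕ λ k → enum k ≡ x

  toLO : LO
  toLO = record { Car = Carrier ; _<_ = _≺_ }

open CountableOrder using (toLO)

-- The inverse of Cantor's pairing: ℕ × ℕ is enumerated along the antidiagonals.
antidiagonal-next : ℕ × ℕ → ℕ × ℕ
antidiagonal-next (zero , b) = suc b , zero
antidiagonal-next (suc a , b) = a , suc b

unpair : ℕ → ℕ × ℕ
unpair zero = 0 , 0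
unpair (suc n) = antidiagonal-next (unpair n)

unpair-surj : ∀ a b → Σ ℕ λ n → unpair n ≡ (a , b)
unpair-surj a b = go (a + b) b a refl
  where
  go : ∀ s b a → a + b ≡ s → Σ ℕ λ n → unpair n ≡ (a , b)
  go s (suc b) a e with go s b (suc a) (trans (sym (ℕ.+-suc a b)) e)
  ... | n , p = suc n , cong antidiagonal-next p
  go s zero zero e = zero , refl
  go (suc s) zero (suc a) e with go s a zero (trans (sym (ℕ.+-identityʳ a)) (ℕ.suc-injective e))
  ... | n , p = suc n , cong antidiagonal-next p

ΣCountable : (I : CountableOrder) → (CountableOrder.Carrier I → CountableOrder) → CountableOrder
ΣCountable I F = record
  { Carrier = Σ I.Carrier λ i → F.Carrier i ; _≺_ = Lex I._≺_ (λ i → toLO (F i))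
  ; irrefl = irrefl' ; ≺-trans = trans' ; trichotomy = trichotomy' ; enum = enum' ; enum-surj = enum-surj' }
  where
  module I = CountableOrder I
  module F i = CountableOrder (F i)
  _≺_ = Lex I._≺_ (λ i → toLO (F i))
  irrefl' : ∀ {x} → ¬ x ≺ x
  irrefl' (fst< r) = I.irrefl r
  irrefl' {i , _} (snd< q) = F.irrefl i q
  trans' : ∀ {x y z} → x ≺ y → y ≺ z → x ≺ z
  trans' (fst< r) (fst< r') = fst< (I.≺-trans r r')
  trans' (fst< r) (snd< _) = fst< r
  trans' (snd< _) (fst< r) = fst< r
  trans' {i , _} (snd< q) (snd< q') = snd< (F.≺-trans i q q')
  trichotomy' : ∀ x y → x ≺ y ⊎ x ≡ y ⊎ y ≺ x
  trichotomy' (i , x) (j , y) with I.trichotomy i j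
  ... | inj₁ r = inj₁ (fst< r)
  ... | inj₂ (inj₂ r) = inj₂ (inj₂ (fst< r))
  ... | inj₂ (inj₁ refl) with F.trichotomy i x y
  ...   | inj₁ q = inj₁ (snd< q)
  ...   | inj₂ (inj₁ refl) = inj₂ (inj₁ refl)
  ...   | inj₂ (inj₂ q) = inj₂ (inj₂ (snd< q))
  enum-pair : ℕ × ℕ → Σ I.Carrier F.Carrier
  enum-pair (a , b) = I.enum a , F.enum (I.enum a) b
  enum' : ℕ → Σ I.Carrier F.Carrier
  enum' n = enum-pair (unpair n)
  enum-surj' : ∀ p → Σ ℕ λ k → enum' k ≡ p
  enum-surj' (i , x) with I.enum-surj i
  ... | a , refl with F.enum-surj (I.enum a) x
  ...   | b , refl = let n , e = unpair-surj a b in n , cong enum-pair e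

Tri⇒⊎ : ∀ {A B C : Set} → Tri A B C → A ⊎ B ⊎ C
Tri⇒⊎ (tri< a _ _) = inj₁ a
Tri⇒⊎ (tri≈ _ b _) = inj₂ (inj₁ b)
Tri⇒⊎ (tri> _ _ c) = inj₂ (inj₂ c)

oneCountable : CountableOrder
oneCountable = record
  { Carrier = ⊤ ; _≺_ = λ _ _ → ⊥ ; irrefl = λ () ; ≺-trans = λ ()
  ; trichotomy = λ _ _ → inj₂ (inj₁ refl) ; enum = λ _ → tt ; enum-surj = λ _ → 0 , refl }

FinCountable : ∀ m → .{{ℕ.NonZero m}} → CountableOrder
FinCountable m = record
  { Carrier = Fin m ; _≺_ = Fin._<_ ; irrefl = Fin.<-irrefl refl ; ≺-trans = Fin.<-trans
  ; trichotomy = λ x y → Tri⇒⊎ (Fin.<-cmp x y) ; enum = enum' ; enum-surj = λ x → toℕ x , enum-toℕ x }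
  where
  enum' : ℕ → Fin m
  enum' n with n <? m
  ... | yes p = fromℕ< p
  ... | no _ = fromℕ< (ℕ.>-nonZero⁻¹ m)
  enum-toℕ : ∀ x → enum' (toℕ x) ≡ x
  enum-toℕ x with toℕ x <? m
  ... | yes p = Fin.fromℕ<-toℕ x p
  ... | no ¬p = ⊥-elim (¬p (Fin.toℕ<n x))

ℕCountable : CountableOrder
ℕCountable = record
  { Carrier = ℕ ; _≺_ = _<_ ; irrefl = ℕ.<-irrefl refl ; ≺-trans = ℕ.<-trans
  ; trichotomy = λ x y → Tri⇒⊎ (ℕ.<-cmp x y) ; enum = λ n → n ; enum-surj = λ x → x , refl }

-- Cutting ℕ into the consecutive blocks [offset i , offset i + width i].
module Blocks (width : ℕ → ℕ) where

  offset : ℕ → ℕ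
  offset zero = 0
  offset (suc i) = offset i + suc (width i)

  private
    J = ΣCountable ℕCountable (λ i → FinCountable (suc (width i)))
    module J = CountableOrder J

    position : J.Carrier → ℕ
    position (i , k) = offset i + toℕ k

    next : J.Carrier → J.Carrier
    next (i , k) with toℕ k <? width i
    ... | yes k<w = i , fromℕ< (s≤s k<w)
    ... | no _ = suc i , zero

  locate : ℕ → Σ ℕ λ i → Fin (suc (width i))
  locate zero = 0 , zero
  locate (suc n) = next (locate n)

  private
    position-next : ∀ j → position (next j) ≡ suc (position j)
    position-next (i , k) with toℕ k <? width i
    ... | yes k<w = trans (cong (offset i +_) (Fin.toℕ-fromℕ< (s≤s k<w))) (ℕ.+-suc (offset i) (toℕ k))
    ... | no k≮w =
      trans (ℕ.+-identityʳ _) (trans (ℕ.+-suc (offset i) (width i)) (cong (λ z → suc (offset i + z)) (sym k≡w)))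
      where
      k≡w : toℕ k ≡ width i
      k≡w = ℕ.≤∧≮⇒≡ (ℕ.≤-pred (Fin.toℕ<n k)) k≮w

    position-locate : ∀ n → position (locate n) ≡ n
    position-locate zero = refl
    position-locate (suc n) = trans (position-next (locate n)) (cong suc (position-locate n))

    offset-mono : ∀ {i i'} → i ≤ i' → offset i ≤ offset i'
    offset-mono {i} {i'} i≤i' with ℕ.m≤n⇒m<n∨m≡n i≤i'
    ... | inj₂ refl = ℕ.≤-refl
    offset-mono {i} {suc i'} _ | inj₁ (s≤s i≤i') =
      ℕ.≤-trans (offset-mono i≤i') (ℕ.m≤m+n (offset i') (suc (width i')))

    position-mono : ∀ {j j'} → j J.≺ j' → position j < position j'
    position-mono {i , k} {i' , k'} (fst< i<i') =
      ℕ.<-≤-trans (ℕ.+-monoʳ-< (offset i) (Fin.toℕ<n k))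
                  (ℕ.≤-trans (offset-mono i<i') (ℕ.m≤m+n (offset i') (toℕ k')))
    position-mono {i , k} (snd< k<k') = ℕ.+-monoʳ-< (offset i) k<k'

    position-injective : ∀ {j j'} → position j ≡ position j' → j ≡ j'
    position-injective {j} {j'} e with J.trichotomy j j'
    ... | inj₁ j<j' = ⊥-elim (ℕ.<-irrefl e (position-mono j<j'))
    ... | inj₂ (inj₁ j≡j') = j≡j'
    ... | inj₂ (inj₂ j'<j) = ⊥-elim (ℕ.<-irrefl (sym e) (position-mono j'<j))

    position≅ : toLO J ≅ record { Car = ℕ ; _<_ = _<_ }
    position≅ = record
      { to = position ; from = locate
      ; from-to = λ j → position-injective (position-locate (position j)) ; to-from = position-locate
      ; mono = position-mono ; refl< = reflect }
      where
      reflect : ∀ {j j'} → position j < position j' → j J.≺ j'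
      reflect {j} {j'} p<p' with J.trichotomy j j'
      ... | inj₁ j<j' = j<j'
      ... | inj₂ (inj₁ refl) = ⊥-elim (ℕ.<-irrefl refl p<p')
      ... | inj₂ (inj₂ j'<j) = ⊥-elim (ℕ.<-asym p<p' (position-mono j'<j))

  flatten : ∀ (G : ∀ i → Fin (suc (width i)) → LO) →
            ΣLO ℕ _<_ (λ i → ΣLO (Fin (suc (width i))) Fin._<_ (G i)) ≅
            ΣLO ℕ _<_ (λ n → G (proj₁ (locate n)) (proj₂ (locate n)))
  flatten G = ≅-trans ΣLO-assoc (≅-sym (ΣLO-reindex {G = λ j → G (proj₁ j) (proj₂ j)} (≅-sym position≅)))

  regroup : ∀ F → ΣLO ℕ _<_ F ≅ ΣLO ℕ _<_ (λ i → blockLO F (offset i) (width i))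
  regroup F = ≅-trans (≅-sym (ΣLO-reindex {G = F} position≅)) (≅-sym ΣLO-assoc)

-- Countable dense coloured orders and the back-and-forth argument

record DenseColouredOrder (C : Set) : Set₁ where
  field
    countable : CountableOrder
  open CountableOrder countable public
  field
    colour : Carrier → C
    point  : Carrier
    noMin  : ∀ x → Σ Carrier λ y → y ≺ x
    noMax  : ∀ x → Σ Carrier λ y → x ≺ y
    dense  : ∀ {x y} → x ≺ y → ∀ c → Σ Carrier λ z → x ≺ z × z ≺ y × colour z ≡ c

  inhabits : ∀ c → Σ Carrier λ z → colour z ≡ c
  inhabits c = let _ , p<y = noMax point ; z , _ , _ , cz = dense p<y c in z , cz

module Extension {C : Set} (A B : DenseColouredOrder C) where
  private
    module A = DenseColouredOrder A
    module B = DenseColouredOrder B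
  open A using () renaming (_≺_ to _<A_)
  open B using () renaming (_≺_ to _<B_)

  PartialIso : Set
  PartialIso = List (A.Carrier × B.Carrier)

  OrderPreserving : PartialIso → Set
  OrderPreserving p =
    ∀ {a b a' b'} → (a , b) ∈ p → (a' , b') ∈ p → (a <A a' → b <B b') × (b <B b' → a <A a')

  ColourPreserving : PartialIso → Set
  ColourPreserving p = ∀ {a b} → (a , b) ∈ p → B.colour b ≡ A.colour a

  _≼_ : B.Carrier → B.Carrier → Set
  x ≼ y = x <B y ⊎ x ≡ y

  ≼-<-trans : ∀ {x y z} → x ≼ y → y <B z → x <B z
  ≼-<-trans (inj₁ p) q = B.≺-trans p q
  ≼-<-trans (inj₂ refl) q = q

  <-≼-trans : ∀ {x y z} → x <B y → y ≼ z → x <B z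
  <-≼-trans p (inj₁ q) = B.≺-trans p q
  <-≼-trans p (inj₂ refl) = p

  ≼-trans : ∀ {x y z} → x ≼ y → y ≼ z → x ≼ z
  ≼-trans (inj₁ p) q = inj₁ (<-≼-trans p q)
  ≼-trans (inj₂ refl) q = q

  record LowerBound (p : PartialIso) (a : A.Carrier) (lo : Maybe B.Carrier) : Set where
    field
      bounds   : ∀ {a' b'} → (a' , b') ∈ p → a' <A a → Σ B.Carrier λ l → lo ≡ just l × b' ≼ l
      attained : ∀ {l} → lo ≡ just l → Σ A.Carrier λ a' → (a' , l) ∈ p × a' <A a

  record UpperBound (p : PartialIso) (a : A.Carrier) (hi : Maybe B.Carrier) : Set where
    field
      bounds   : ∀ {a' b'} → (a' , b') ∈ p → a <A a' → Σ B.Carrier λ h → hi ≡ just h × h ≼ b'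
      attained : ∀ {h} → hi ≡ just h → Σ A.Carrier λ a' → (a' , h) ∈ p × a <A a'

  max : (lo : Maybe B.Carrier) (b : B.Carrier) →
        Σ B.Carrier λ l → b ≼ l × (∀ {l₀} → lo ≡ just l₀ → l₀ ≼ l) × (l ≡ b ⊎ lo ≡ just l)
  max nothing b = b , inj₂ refl , (λ ()) , inj₁ refl
  max (just l₀) b with B.trichotomy b l₀
  ... | inj₁ b<l₀ = l₀ , inj₁ b<l₀ , (λ { refl → inj₂ refl }) , inj₂ refl
  ... | inj₂ (inj₁ b≡l₀) = l₀ , inj₂ b≡l₀ , (λ { refl → inj₂ refl }) , inj₂ refl
  ... | inj₂ (inj₂ l₀<b) = b , inj₂ refl , (λ { refl → inj₁ l₀<b }) , inj₁ refl

  min : (hi : Maybe B.Carrier) (b : B.Carrier) →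
        Σ B.Carrier λ h → h ≼ b × (∀ {h₀} → hi ≡ just h₀ → h ≼ h₀) × (h ≡ b ⊎ hi ≡ just h)
  min nothing b = b , inj₂ refl , (λ ()) , inj₁ refl
  min (just h₀) b with B.trichotomy b h₀
  ... | inj₁ b<h₀ = b , inj₂ refl , (λ { refl → inj₁ b<h₀ }) , inj₁ refl
  ... | inj₂ (inj₁ b≡h₀) = h₀ , inj₂ (sym b≡h₀) , (λ { refl → inj₂ refl }) , inj₂ refl
  ... | inj₂ (inj₂ h₀<b) = h₀ , inj₁ h₀<b , (λ { refl → inj₂ refl }) , inj₂ refl

  ≡-or->⇒≮ : ∀ {x y} → x ≡ y ⊎ y <A x → ¬ x <A y
  ≡-or->⇒≮ (inj₁ refl) x<x = A.irrefl x<x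
  ≡-or->⇒≮ (inj₂ y<x) x<y = A.irrefl (A.≺-trans x<y y<x)

  lowerBound : ∀ p a → Σ (Maybe B.Carrier) (LowerBound p a)
  lowerBound [] a = nothing , record { bounds = λ () ; attained = λ () }
  lowerBound ((a' , b') ∷ p) a with lowerBound p a | A.trichotomy a' a
  ... | lo , L | inj₁ a'<a =
    let l , b'≼l , lo≼l , l∈ = max lo b' in
    just l , record
      { bounds = λ { (here refl) _ → l , refl , b'≼l
                   ; (there m) q → let _ , e , b≼ = LowerBound.bounds L m q in l , refl , ≼-trans b≼ (lo≼l e) }
      ; attained = λ { refl → attained l∈ } }
    where
    attained : ∀ {l} → l ≡ b' ⊎ lo ≡ just l → Σ A.Carrier λ a'' → (a'' , l) ∈ ((a' , b') ∷ p) × a'' <A a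
    attained (inj₁ refl) = a' , here refl , a'<a
    attained (inj₂ e) = let a'' , m , q = LowerBound.attained L e in a'' , there m , q
  ... | lo , L | inj₂ a'≥a = lo , record
      { bounds = λ { (here refl) a'<a → ⊥-elim (≡-or->⇒≮ a'≥a a'<a) ; (there m) → LowerBound.bounds L m }
      ; attained = λ e → let a'' , m , q = LowerBound.attained L e in a'' , there m , q }

  upperBound : ∀ p a → Σ (Maybe B.Carrier) (UpperBound p a)
  upperBound [] a = nothing , record { bounds = λ () ; attained = λ () }
  upperBound ((a' , b') ∷ p) a with upperBound p a | A.trichotomy a a'
  ... | hi , H | inj₁ a<a' =
    let h , h≼b' , h≼hi , h∈ = min hi b' in
    just h , record
      { bounds = λ { (here refl) _ → h , refl , h≼b'
                   ; (there m) q → let _ , e , ≼b = UpperBound.bounds H m q in h , refl , ≼-trans (h≼hi e) ≼b }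
      ; attained = λ { refl → attained h∈ } }
    where
    attained : ∀ {h} → h ≡ b' ⊎ hi ≡ just h → Σ A.Carrier λ a'' → (a'' , h) ∈ ((a' , b') ∷ p) × a <A a''
    attained (inj₁ refl) = a' , here refl , a<a'
    attained (inj₂ e) = let a'' , m , q = UpperBound.attained H e in a'' , there m , q
  ... | hi , H | inj₂ a≥a' = hi , record
      { bounds = λ { (here refl) a<a' → ⊥-elim (≡-or->⇒≮ a≥a' a<a') ; (there m) → UpperBound.bounds H m }
      ; attained = λ e → let a'' , m , q = UpperBound.attained H e in a'' , there m , q }

  between : (lo hi : Maybe B.Carrier) → (∀ {l h} → lo ≡ just l → hi ≡ just h → l <B h) → (c : C) →
            Σ B.Carrier λ b →
              (∀ {l} → lo ≡ just l → l <B b) × (∀ {h} → hi ≡ just h → b <B h) × B.colour b ≡ c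
  between nothing nothing _ c =
    let _ , q = B.noMax B.point ; z , _ , _ , cz = B.dense q c in z , (λ ()) , (λ ()) , cz
  between (just l) nothing _ c =
    let _ , q = B.noMax l ; z , l<z , _ , cz = B.dense q c in z , (λ { refl → l<z }) , (λ ()) , cz
  between nothing (just h) _ c =
    let _ , q = B.noMin h ; z , _ , z<h , cz = B.dense q c in z , (λ ()) , (λ { refl → z<h }) , cz
  between (just l) (just h) l<h c =
    let z , l<z , z<h , cz = B.dense (l<h refl refl) c in z , (λ { refl → l<z }) , (λ { refl → z<h }) , cz

  lookupA : (p : PartialIso) (a : A.Carrier) → (Σ B.Carrier λ b → (a , b) ∈ p) ⊎ (∀ {b} → ¬ (a , b) ∈ p)
  lookupA [] a = inj₂ (λ ())
  lookupA ((a' , b') ∷ p) a with A.trichotomy a a' | lookupA p a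
  ... | inj₂ (inj₁ refl) | _ = inj₁ (b' , here refl)
  ... | _ | inj₁ (b , m) = inj₁ (b , there m)
  ... | inj₁ a<a' | inj₂ ∉p = inj₂ λ { (here refl) → A.irrefl a<a' ; (there m) → ∉p m }
  ... | inj₂ (inj₂ a'<a) | inj₂ ∉p = inj₂ λ { (here refl) → A.irrefl a'<a ; (there m) → ∉p m }

  Consistent : PartialIso → Set
  Consistent p = OrderPreserving p × ColourPreserving p

  extend-known : ∀ {p a b} → Consistent p → (a , b) ∈ p → Consistent ((a , b) ∷ p)
  extend-known (op , cp) m =
    (λ { (here refl) (here refl) → op m m ; (here refl) (there m') → op m m'
       ; (there m₁) (here refl) → op m₁ m ; (there m₁) (there m') → op m₁ m' })
    , λ { (here refl) → cp m ; (there m') → cp m' }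

  extend-new : ∀ {p} → Consistent p → (a : A.Carrier) → (∀ {b} → ¬ (a , b) ∈ p) →
               Σ B.Carrier λ b → Consistent ((a , b) ∷ p)
  extend-new {p} (op , cp) a ∉p = b , order , colour
    where
    lo = proj₁ (lowerBound p a)
    hi = proj₁ (upperBound p a)
    module L = LowerBound (proj₂ (lowerBound p a))
    module H = UpperBound (proj₂ (upperBound p a))
    lo<hi : ∀ {l h} → lo ≡ just l → hi ≡ just h → l <B h
    lo<hi e e' = let _ , m , q = L.attained e ; _ , m' , q' = H.attained e' in proj₁ (op m m') (A.≺-trans q q')
    chosen = between lo hi lo<hi (A.colour a)
    b = proj₁ chosen
    above : ∀ {a' b'} → (a' , b') ∈ p → a' <A a → b' <B b
    above m q = let _ , e , r = L.bounds m q in ≼-<-trans r (proj₁ (proj₂ chosen) e)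
    below : ∀ {a' b'} → (a' , b') ∈ p → a <A a' → b <B b'
    below m q = let _ , e , r = H.bounds m q in <-≼-trans (proj₁ (proj₂ (proj₂ chosen)) e) r
    reflect : ∀ {a' b'} → (a' , b') ∈ p → (b <B b' → a <A a') × (b' <B b → a' <A a)
    reflect {a'} m with A.trichotomy a a'
    ... | inj₁ a<a' = (λ _ → a<a') , λ b'<b → ⊥-elim (B.irrefl (B.≺-trans b'<b (below m a<a')))
    ... | inj₂ (inj₁ refl) = ⊥-elim (∉p m)
    ... | inj₂ (inj₂ a'<a) = (λ b<b' → ⊥-elim (B.irrefl (B.≺-trans b<b' (above m a'<a)))) , λ _ → a'<a
    order : OrderPreserving ((a , b) ∷ p)
    order (here refl) (here refl) = (λ a<a → ⊥-elim (A.irrefl a<a)) , λ b<b → ⊥-elim (B.irrefl b<b)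
    order (here refl) (there m) = below m , proj₁ (reflect m)
    order (there m) (here refl) = above m , proj₂ (reflect m)
    order (there m) (there m') = op m m'
    colour : ColourPreserving ((a , b) ∷ p)
    colour (here refl) = proj₂ (proj₂ (proj₂ chosen))
    colour (there m) = cp m

  extend : ∀ {p} → Consistent p → (a : A.Carrier) → Σ B.Carrier λ b → Consistent ((a , b) ∷ p)
  extend c a with lookupA _ a
  ... | inj₁ (b , m) = b , extend-known c m
  ... | inj₂ ∉p = extend-new c a ∉p

module _ {C : Set} (A B : DenseColouredOrder C) where
  private
    module A = DenseColouredOrder A
    module B = DenseColouredOrder B
    module Back = Extension B A
  open Extension A B
  open A using () renaming (_≺_ to _<A_)
  open B using () renaming (_≺_ to _<B_)

  private
    swap-∈ : ∀ {a b} {p : PartialIso} → (a , b) ∈ p → (b , a) ∈ map swap p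
    swap-∈ = ∈-map⁺ swap

    unswap-∈ : ∀ {a b} {p : PartialIso} → (b , a) ∈ map swap p → (a , b) ∈ p
    unswap-∈ m with ∈-map⁻ swap m
    ... | _ , m' , refl = m'

    swap-consistent : ∀ {p} → Consistent p → Back.Consistent (map swap p)
    swap-consistent (op , cp) = (λ m m' → swap (op (unswap-∈ m) (unswap-∈ m'))) , λ m → sym (cp (unswap-∈ m))

    unswap-consistent : ∀ {p} → Back.Consistent (map swap p) → Consistent p
    unswap-consistent (op , cp) = (λ m m' → swap (op (swap-∈ m) (swap-∈ m'))) , λ m → sym (cp (swap-∈ m))

    Stage : Set
    Stage = Σ PartialIso Consistent

    step : Stage → ℕ → B.Carrier × A.Carrier × Stage
    step (p , c) n =
      let b , c₁ = extend c (A.enum n)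
          p₁ = (A.enum n , b) ∷ p
          a , c₂ = Back.extend (swap-consistent c₁) (B.enum n)
      in b , a , (a , B.enum n) ∷ p₁ , unswap-consistent {(a , B.enum n) ∷ p₁} c₂

    stage : ℕ → Stage
    stage zero = [] , (λ ()) , (λ ())
    stage (suc n) = proj₂ (proj₂ (step (stage n) n))

    pairs : ℕ → PartialIso
    pairs n = proj₁ (stage n)

    pairs-mono : ∀ {m n} → m ≤ n → ∀ {x} → x ∈ pairs m → x ∈ pairs n
    pairs-mono {n = n} m≤n with ℕ.m≤n⇒m<n∨m≡n m≤n
    ... | inj₂ refl = λ x → x
    pairs-mono {n = suc n} _ | inj₁ (s≤s m≤n) = λ x → there (there (pairs-mono m≤n x))

    order : ∀ m n {a b a' b'} → (a , b) ∈ pairs m → (a' , b') ∈ pairs n →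
            (a <A a' → b <B b') × (b <B b' → a <A a')
    order m n x y =
      proj₁ (proj₂ (stage (m ℕ.⊔ n))) (pairs-mono (ℕ.m≤m⊔n m n) x) (pairs-mono (ℕ.m≤n⊔m m n) y)

    functional : ∀ m n {a b b'} → (a , b) ∈ pairs m → (a , b') ∈ pairs n → b ≡ b'
    functional m n {b = b} {b'} x y with B.trichotomy b b'
    ... | inj₁ b<b' = ⊥-elim (A.irrefl (proj₂ (order m n x y) b<b'))
    ... | inj₂ (inj₁ e) = e
    ... | inj₂ (inj₂ b'<b) = ⊥-elim (A.irrefl (proj₂ (order n m y x) b'<b))

    injective : ∀ m n {a a' b} → (a , b) ∈ pairs m → (a' , b) ∈ pairs n → a ≡ a'
    injective m n {a} {a'} x y with A.trichotomy a a'
    ... | inj₁ a<a' = ⊥-elim (B.irrefl (proj₁ (order m n x y) a<a'))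
    ... | inj₂ (inj₁ e) = e
    ... | inj₂ (inj₂ a'<a) = ⊥-elim (B.irrefl (proj₁ (order n m y x) a'<a))

    stageA : A.Carrier → ℕ
    stageA a = suc (proj₁ (A.enum-surj a))

    stageB : B.Carrier → ℕ
    stageB b = suc (proj₁ (B.enum-surj b))

    forth : A.Carrier → B.Carrier
    forth a = proj₁ (step (stage (proj₁ (A.enum-surj a))) (proj₁ (A.enum-surj a)))

    back : B.Carrier → A.Carrier
    back b = proj₁ (proj₂ (step (stage (proj₁ (B.enum-surj b))) (proj₁ (B.enum-surj b))))

    forth-∈ : ∀ a → (a , forth a) ∈ pairs (stageA a)
    forth-∈ a with A.enum-surj a
    ... | _ , refl = there (here refl)

    back-∈ : ∀ b → (back b , b) ∈ pairs (stageB b)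
    back-∈ b with B.enum-surj b
    ... | _ , refl = here refl

  back-and-forth : Σ (A.toLO ≅ B.toLO) λ φ → ∀ x → B.colour (to φ x) ≡ A.colour x
  back-and-forth =
    record
      { to = forth ; from = back
      ; from-to = λ a → injective (stageB (forth a)) (stageA a) (back-∈ (forth a)) (forth-∈ a)
      ; to-from = λ b → functional (stageA (back b)) (stageB b) (forth-∈ (back b)) (back-∈ b)
      ; mono = λ {x} {y} → proj₁ (order (stageA x) (stageA y) (forth-∈ x) (forth-∈ y))
      ; refl< = λ {x} {y} → proj₂ (order (stageA x) (stageA y) (forth-∈ x) (forth-∈ y)) }
    , λ a → proj₂ (proj₂ (stage (stageA a))) (forth-∈ a)

-- Shuffles of linear orders

shuffleLO : ∀ {C} → DenseColouredOrder C → (C → LO) → LO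
shuffleLO E F = ΣLO E.Carrier E._≺_ (λ q → F (E.colour q))
  where module E = DenseColouredOrder E

shuffleLO-ascending : ∀ {C} (E : DenseColouredOrder C) (F : C → LO) → (∀ c → Car (F c)) →
                      AscendingChain (shuffleLO E F)
shuffleLO-ascending E F element = (λ n → q n , element (E.colour (q n))) , λ n → fst< (proj₂ (E.noMax (q n)))
  where
  module E = DenseColouredOrder E
  q : ℕ → E.Carrier
  q zero = E.point
  q (suc n) = proj₁ (E.noMax (q n))

shuffleLO-unique : ∀ {C} (E E' : DenseColouredOrder C) (F : C → LO) → shuffleLO E F ≅ shuffleLO E' F
shuffleLO-unique E E' F =
  let φ , φ-colour = back-and-forth E E' in
  ≅-trans (ΣLO-congʳ (λ q → ≡⇒≅ (cong F (sym (φ-colour q))))) (ΣLO-reindex φ)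

recolour : ∀ {C C'} → DenseColouredOrder C → (ρ : C → C') → (∀ c' → Σ C λ c → ρ c ≡ c') →
           DenseColouredOrder C'
recolour E ρ ρ-surj = record
  { countable = E.countable ; colour = λ x → ρ (E.colour x) ; point = E.point ; noMin = E.noMin ; noMax = E.noMax
  ; dense = λ q c' → let c , ρc≡c' = ρ-surj c' ; z , x<z , z<y , cz = E.dense q c
                     in z , x<z , z<y , trans (cong ρ cz) ρc≡c' }
  where module E = DenseColouredOrder E

data Piece (C : Set) : Set₁ where
  point : C → Piece C
  dense : DenseColouredOrder C → Piece C

pieceOrder : ∀ {C} → Piece C → CountableOrder
pieceOrder (point _) = oneCountable
pieceOrder (dense E) = DenseColouredOrder.countable E

pieceColour : ∀ {C} (p : Piece C) → CountableOrder.Carrier (pieceOrder p) → C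
pieceColour (point c) _ = c
pieceColour (dense E) x = DenseColouredOrder.colour E x

pieceLO : ∀ {C} → (C → LO) → Piece C → LO
pieceLO F p = ΣLO P.Carrier P._≺_ (λ x → F (pieceColour p x))
  where module P = CountableOrder (pieceOrder p)

pieceLO-point : ∀ {C} (F : C → LO) c → pieceLO F (point c) ≅ F c
pieceLO-point F c = ΣLO-unit (F c)

IsDense : ∀ {C} → Piece C → Set
IsDense (point _) = ⊥
IsDense (dense _) = ⊤

IsPoint : ∀ {C} → Piece C → Set
IsPoint (point _) = ⊤
IsPoint (dense _) = ⊥

module _ {C : Set} where
  private
    module P (p : Piece C) = CountableOrder (pieceOrder p)

  point-or-dense : (p : Piece C) → IsPoint p ⊎ IsDense p
  point-or-dense (point _) = inj₁ tt
  point-or-dense (dense _) = inj₂ tt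

  piece-element : (p : Piece C) → P.Carrier p
  piece-element (point _) = tt
  piece-element (dense E) = DenseColouredOrder.point E

  piece-noMin : (p : Piece C) → IsDense p → ∀ x → Σ (P.Carrier p) λ y → P._≺_ p y x
  piece-noMin (dense E) _ = DenseColouredOrder.noMin E

  piece-noMax : (p : Piece C) → IsDense p → ∀ x → Σ (P.Carrier p) λ y → P._≺_ p x y
  piece-noMax (dense E) _ = DenseColouredOrder.noMax E

  piece-dense : (p : Piece C) → ∀ {x y} → P._≺_ p x y → ∀ c →
                Σ (P.Carrier p) λ z → P._≺_ p x z × P._≺_ p z y × pieceColour p z ≡ c
  piece-dense (dense E) = DenseColouredOrder.dense E

  piece-inhabits : (p : Piece C) → IsDense p → ∀ c → Σ (P.Carrier p) λ z → pieceColour p z ≡ c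
  piece-inhabits (dense E) _ = DenseColouredOrder.inhabits E

module ΣPieces {C : Set} (I : CountableOrder) (pc : CountableOrder.Carrier I → Piece C)
  (separated : ∀ {i j} → IsPoint (pc i) → IsPoint (pc j) → CountableOrder._≺_ I i j →
               Σ (CountableOrder.Carrier I) λ k →
                 IsDense (pc k) × CountableOrder._≺_ I i k × CountableOrder._≺_ I k j)
  (below : ∀ {i} → IsPoint (pc i) → Σ (CountableOrder.Carrier I) λ j → CountableOrder._≺_ I j i)
  (above : ∀ {i} → IsPoint (pc i) → Σ (CountableOrder.Carrier I) λ j → CountableOrder._≺_ I i j) where

  private
    module I = CountableOrder I
    X = ΣCountable I (λ i → pieceOrder (pc i))
    module X = CountableOrder X
    colourX : X.Carrier → C
    colourX (i , x) = pieceColour (pc i) x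

    noMin' : ∀ x → Σ X.Carrier λ y → y X.≺ x
    noMin' (i , x) with point-or-dense (pc i)
    ... | inj₂ d = let y , y<x = piece-noMin (pc i) d x in (i , y) , snd< y<x
    ... | inj₁ p = let j , j<i = below p in (j , piece-element (pc j)) , fst< j<i

    noMax' : ∀ x → Σ X.Carrier λ y → x X.≺ y
    noMax' (i , x) with point-or-dense (pc i)
    ... | inj₂ d = let y , x<y = piece-noMax (pc i) d x in (i , y) , snd< x<y
    ... | inj₁ p = let j , i<j = above p in (j , piece-element (pc j)) , fst< i<j

    dense' : ∀ {x y} → x X.≺ y → ∀ c → Σ X.Carrier λ z → x X.≺ z × z X.≺ y × colourX z ≡ c
    dense' {i , _} (snd< x<y) c =
      let z , x<z , z<y , cz = piece-dense (pc i) x<y c in (i , z) , snd< x<z , snd< z<y , cz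
    dense' {i , x} {j , y} (fst< i<j) c with point-or-dense (pc i) | point-or-dense (pc j)
    ... | inj₂ d | _ =
      let x' , x<x' = piece-noMax (pc i) d x ; z , x<z , _ , cz = piece-dense (pc i) x<x' c
      in (i , z) , snd< x<z , fst< i<j , cz
    ... | inj₁ _ | inj₂ d =
      let y' , y'<y = piece-noMin (pc j) d y ; z , _ , z<y , cz = piece-dense (pc j) y'<y c
      in (j , z) , fst< i<j , snd< z<y , cz
    ... | inj₁ p | inj₁ p' =
      let k , d , i<k , k<j = separated p p' i<j ; z , cz = piece-inhabits (pc k) d c
      in (k , z) , fst< i<k , fst< k<j , cz

  denseColoured : DenseColouredOrder C
  denseColoured = record
    { countable = X ; colour = colourX ; point = X.enum 0
    ; noMin = noMin' ; noMax = noMax' ; dense = dense' }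

  ΣPieces≅shuffle : ∀ (F : C → LO) (E : DenseColouredOrder C) →
                    ΣLO I.Carrier I._≺_ (λ i → pieceLO F (pc i)) ≅ shuffleLO E F
  ΣPieces≅shuffle F E = ≅-trans ΣLO-assoc (shuffleLO-unique denseColoured E F)

shuffleLO-merge : ∀ {C C'} (E : DenseColouredOrder C) (E' : DenseColouredOrder C') {F : C → LO} (G : C' → LO)
                  (π : C → C') → (∀ c' → Σ C λ c → π c ≡ c') → (∀ c → F c ≅ G (π c)) →
                  shuffleLO E F ≅ shuffleLO E' G
shuffleLO-merge E E' G π π-surj F≅G =
  ≅-trans (ΣLO-congʳ (λ q → F≅G (DenseColouredOrder.colour E q))) (shuffleLO-unique (recolour E π π-surj) E' G)

module _ {C : Set} (E : DenseColouredOrder C) (F : C → LO) where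
  private
    S = shuffleLO E F

  shuffleLO-idem : sumLO S S ≅ S
  shuffleLO-idem = begin
    sumLO S S                       ≅⟨ ΣLO-Fin2 (λ _ → S) ⟨
    ΣLO (Fin 2) Fin._<_ (λ _ → S)   ≅⟨ ΣPieces≅shuffle F E ⟩
    S                               ∎
    where open ΣPieces (FinCountable 2) (λ _ → dense E) (λ ()) (λ ()) (λ ())

  shuffleLO-absorb : ∀ c → sumLO S (sumLO (F c) S) ≅ S
  shuffleLO-absorb c = begin
    sumLO S (sumLO (F c) S)                        ≅⟨ sumLO-cong ≅-refl (sumLO-cong (pieceLO-point F c) ≅-refl) ⟨
    sumLO S (sumLO (pieceLO F (point c)) S)        ≅⟨ ΣLO-Fin3 (λ i → pieceLO F (pc i)) ⟨
    ΣLO (Fin 3) Fin._<_ (λ i → pieceLO F (pc i))   ≅⟨ ΣPieces≅shuffle F E ⟩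
    S                                              ∎
    where
    pc : Fin 3 → Piece C
    pc (suc zero) = point c
    pc _ = dense E
    separated : ∀ {i j} → IsPoint (pc i) → IsPoint (pc j) → i Fin.< j →
                Σ (Fin 3) λ k → IsDense (pc k) × i Fin.< k × k Fin.< j
    separated {suc zero} {suc zero} _ _ (s≤s ())
    below : ∀ {i} → IsPoint (pc i) → Σ (Fin 3) λ j → j Fin.< i
    below {suc zero} _ = zero , s≤s z≤n
    above : ∀ {i} → IsPoint (pc i) → Σ (Fin 3) λ j → i Fin.< j
    above {suc zero} _ = suc (suc zero) , s≤s (s≤s z≤n)
    open ΣPieces (FinCountable 3) pc separated below above

  shuffleLO-ω : ΣLO ℕ _<_ (λ _ → S) ≅ S
  shuffleLO-ω = ΣPieces≅shuffle F E
    where open ΣPieces ℕCountable (λ _ → dense E) (λ ()) (λ ()) (λ ())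

-- Substituting a finite row of pieces for each colour of a shuffle yields a shuffle, provided some
-- row contains a dense piece and no row contains two point pieces without a dense piece between them.
module Substitution {C C' : Set} (E' : DenseColouredOrder C') (width : C' → ℕ)
  (row : (c' : C') → Fin (suc (width c')) → Piece C)
  (row-separated : ∀ c' {a a'} → IsPoint (row c' a) → IsPoint (row c' a') → a Fin.< a' →
                   Σ (Fin (suc (width c'))) λ m → IsDense (row c' m) × a Fin.< m × m Fin.< a')
  (c₀ : C') (a₀ : Fin (suc (width c₀))) (a₀-dense : IsDense (row c₀ a₀)) where

  private
    module E' = DenseColouredOrder E'
    I = ΣCountable E'.countable (λ q → FinCountable (suc (width (E'.colour q))))
    module I = CountableOrder I

    pc : I.Carrier → Piece C
    pc (q , a) = row (E'.colour q) a

    dense-in-row : ∀ {c'} → c' ≡ c₀ → Σ (Fin (suc (width c'))) λ a → IsDense (row c' a)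
    dense-in-row refl = a₀ , a₀-dense

    separated : ∀ {i j} → IsPoint (pc i) → IsPoint (pc j) → i I.≺ j →
                Σ I.Carrier λ k → IsDense (pc k) × i I.≺ k × k I.≺ j
    separated {q , _} pi pj (snd< a<a') =
      let m , d , a<m , m<a' = row-separated (E'.colour q) pi pj a<a' in (q , m) , d , snd< a<m , snd< m<a'
    separated _ _ (fst< q<q') =
      let q'' , q<q'' , q''<q' , c₀-colour = E'.dense q<q' c₀ ; m , d = dense-in-row c₀-colour
      in (q'' , m) , d , fst< q<q'' , fst< q''<q'

    below : ∀ {i} → IsPoint (pc i) → Σ I.Carrier λ j → j I.≺ i
    below {q , _} _ = let q' , q'<q = E'.noMin q in (q' , zero) , fst< q'<q

    above : ∀ {i} → IsPoint (pc i) → Σ I.Carrier λ j → i I.≺ j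
    above {q , _} _ = let q' , q<q' = E'.noMax q in (q' , zero) , fst< q<q'

    open ΣPieces I pc separated below above

  substitution : ∀ (F : C → LO) (E : DenseColouredOrder C) →
                 shuffleLO E' (λ c' → ΣLO (Fin (suc (width c'))) Fin._<_ (λ a → pieceLO F (row c' a))) ≅
                 shuffleLO E F
  substitution F E = ≅-trans ΣLO-assoc (ΣPieces≅shuffle F E)

module _ {A : Set} where

  init-or-last : ∀ (w : List A) x → Fin (length (w ++ [ x ])) → Maybe (Fin (length w))
  init-or-last [] x zero = nothing
  init-or-last (y ∷ ys) x zero = just zero
  init-or-last (y ∷ ys) x (suc i) = Maybe.map suc (init-or-last ys x i)

  lookup-init : ∀ w x i {j} → init-or-last w x i ≡ just j → lookup (w ++ [ x ]) i ≡ lookup w j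
  lookup-init (y ∷ ys) x zero refl = refl
  lookup-init (y ∷ ys) x (suc i) e with init-or-last ys x i in e'
  lookup-init (y ∷ ys) x (suc i) refl | just j = lookup-init ys x i e'

  lookup-last : ∀ w x i → init-or-last w x i ≡ nothing → lookup (w ++ [ x ]) i ≡ x
  lookup-last [] x zero refl = refl
  lookup-last (y ∷ ys) x (suc i) e with init-or-last ys x i in e'
  ... | nothing = lookup-last ys x i e'

  init-or-last-surj : ∀ w x j → Σ (Fin (length (w ++ [ x ]))) λ i → init-or-last w x i ≡ just j
  init-or-last-surj (y ∷ ys) x zero = zero , refl
  init-or-last-surj (y ∷ ys) x (suc j) = let i , e = init-or-last-surj ys x j in suc i , cong (Maybe.map suc) e

  last-index : ∀ w x → Σ (Fin (length (w ++ [ x ]))) λ i → init-or-last w x i ≡ nothing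
  last-index [] x = zero , refl
  last-index (y ∷ ys) x = let i , e = last-index ys x in suc i , cong (Maybe.map suc) e

  take-index : ∀ k (u : List A) → Fin (length (take k u)) → Fin (length u)
  take-index (suc k) (y ∷ ys) zero = zero
  take-index (suc k) (y ∷ ys) (suc j) = suc (take-index k ys j)

  lookup-take : ∀ k (u : List A) j → lookup (take k u) j ≡ lookup u (take-index k u j)
  lookup-take (suc k) (y ∷ ys) zero = refl
  lookup-take (suc k) (y ∷ ys) (suc j) = lookup-take k ys j

-- Syntax of terms

mutual
  size : Term → ℕ
  size one = 1
  size (a ⌢ b) = size a + size b
  size (Q t ts) = suc (size t + sizes ts)

  sizes : List Term → ℕ
  sizes [] = 0
  sizes (x ∷ xs) = size x + sizes xs

size-positive : ∀ t → 1 ≤ size t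
size-positive one = s≤s z≤n
size-positive (a ⌢ b) = ℕ.≤-trans (size-positive a) (ℕ.m≤m+n (size a) (size b))
size-positive (Q t ts) = s≤s z≤n

sizes-++ : ∀ xs ys → sizes (xs ++ ys) ≡ sizes xs + sizes ys
sizes-++ [] ys = refl
sizes-++ (x ∷ xs) ys = trans (cong (size x +_) (sizes-++ xs ys)) (sym (ℕ.+-assoc (size x) (sizes xs) (sizes ys)))

sizes-resp-↭ : ∀ {xs ys} → xs ↭ ys → sizes xs ≡ sizes ys
sizes-resp-↭ ↭.refl = refl
sizes-resp-↭ (↭.prep x p) = cong (size x +_) (sizes-resp-↭ p)
sizes-resp-↭ {x ∷ y ∷ xs} (↭.swap x y p) =
  trans (x∙yz≈y∙xz (size x) (size y) (sizes xs)) (cong (λ n → size y + (size x + n)) (sizes-resp-↭ p))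
sizes-resp-↭ (↭.trans p q) = trans (sizes-resp-↭ p) (sizes-resp-↭ q)

mutual
  size-resp-≈ : ∀ {a b} → a ≈ₜ b → size a ≡ size b
  size-resp-≈ ≈-refl = refl
  size-resp-≈ (≈-sym p) = sym (size-resp-≈ p)
  size-resp-≈ (≈-trans p q) = trans (size-resp-≈ p) (size-resp-≈ q)
  size-resp-≈ (≈-assoc {a} {b} {c}) = ℕ.+-assoc (size a) (size b) (size c)
  size-resp-≈ (≈-⌢ p q) = cong₂ _+_ (size-resp-≈ p) (size-resp-≈ q)
  size-resp-≈ (≈-Q pw) = cong suc (sizes-resp-≈ pw)
  size-resp-≈ (≈-perm p) = cong suc (sizes-resp-↭ p)

  sizes-resp-≈ : ∀ {xs ys} → Pointwise _≈ₜ_ xs ys → sizes xs ≡ sizes ys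
  sizes-resp-≈ [] = refl
  sizes-resp-≈ (p ∷ pw) = cong₂ _+_ (size-resp-≈ p) (sizes-resp-≈ pw)

data Shape : Set where
  one-shape cat-shape Q-shape : Shape

shape : Term → Shape
shape one = one-shape
shape (_ ⌢ _) = cat-shape
shape (Q _ _) = Q-shape

shape-resp-≈ : ∀ {a b} → a ≈ₜ b → shape a ≡ shape b
shape-resp-≈ ≈-refl = refl
shape-resp-≈ (≈-sym p) = sym (shape-resp-≈ p)
shape-resp-≈ (≈-trans p q) = trans (shape-resp-≈ p) (shape-resp-≈ q)
shape-resp-≈ ≈-assoc = refl
shape-resp-≈ (≈-⌢ _ _) = refl
shape-resp-≈ (≈-Q _) = refl
shape-resp-≈ (≈-perm _) = refl

one≉Q : ∀ {t ts} → ¬ one ≈ₜ Q t ts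
one≉Q p with () ← shape-resp-≈ p

⌢≉Q : ∀ {a b t ts} → ¬ a ⌢ b ≈ₜ Q t ts
⌢≉Q p with () ← shape-resp-≈ p

IsQ : Term → Set
IsQ a = Σ Term λ t → Σ (List Term) λ ts → a ≡ Q t ts

IsCat : Term → Set
IsCat a = Σ Term λ b → Σ Term λ c → a ≡ b ⌢ c

HasQ : List Term → Set
HasQ = Any IsQ

singleton-¬BadFactors : ∀ x → ¬ BadFactors [ x ]
singleton-¬BadFactors x ([] , _ , _ , _ , [] , _ , _ , () , _)
singleton-¬BadFactors x ([] , _ , _ , _ , _ ∷ _ , _ , _ , () , _)
singleton-¬BadFactors x (_ ∷ [] , _ , _ , _ , _ , _ , _ , () , _)
singleton-¬BadFactors x (_ ∷ _ ∷ _ , _ , _ , _ , _ , _ , _ , () , _)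

pair-¬BadFactors : ∀ {x y} → ¬ x ≈ₜ y → ¬ BadFactors (x ∷ y ∷ [])
pair-¬BadFactors x≉y ([] , _ , _ , _ , [] , _ , _ , refl , x≈ , y≈ , _) = x≉y (≈-trans x≈ (≈-sym y≈))
pair-¬BadFactors x≉y ([] , _ , _ , _ , _ ∷ [] , _ , _ , () , _)
pair-¬BadFactors x≉y ([] , _ , _ , _ , _ ∷ _ ∷ _ , _ , _ , () , _)
pair-¬BadFactors x≉y (_ ∷ [] , _ , _ , _ , [] , _ , _ , () , _)
pair-¬BadFactors x≉y (_ ∷ [] , _ , _ , _ , _ ∷ _ , _ , _ , () , _)
pair-¬BadFactors x≉y (_ ∷ _ ∷ [] , _ , _ , _ , _ , _ , _ , () , _)
pair-¬BadFactors x≉y (_ ∷ _ ∷ _ ∷ _ , _ , _ , _ , _ , _ , _ , () , _)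

sizes-++-≤ʳ : ∀ xs ys → sizes ys ≤ sizes (xs ++ ys)
sizes-++-≤ʳ xs ys = subst (sizes ys ≤_) (sym (sizes-++ xs ys)) (ℕ.m≤n+m (sizes ys) (sizes xs))

module _ (P : Term) (mid : List Term) (P' : Term) (ys : List Term) where

  window-length : ∀ xs → length (xs ++ P ∷ ys) < length (xs ++ P ∷ mid ++ P' ∷ ys)
  window-length [] = s≤s (length-++-≤ʳ (P' ∷ ys) {mid})
  window-length (x ∷ xs) = s≤s (window-length xs)

  window-sizes : ∀ xs → sizes (xs ++ P ∷ ys) ≤ sizes (xs ++ P ∷ mid ++ P' ∷ ys)
  window-sizes [] =
    ℕ.+-monoʳ-≤ (size P) (ℕ.≤-trans (ℕ.m≤n+m (sizes ys) (size P')) (sizes-++-≤ʳ mid (P' ∷ ys)))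
  window-sizes (x ∷ xs) = ℕ.+-monoʳ-≤ (size x) (window-sizes xs)

  window-head : ∀ xs {h t} → xs ++ P ∷ mid ++ P' ∷ ys ≡ h ∷ t →
                Σ (List Term) λ t' → xs ++ P ∷ ys ≡ h ∷ t'
  window-head [] refl = ys , refl
  window-head (x ∷ xs) refl = xs ++ P ∷ ys , refl

  window-All : ∀ {R : Term → Set} xs → All R (xs ++ P ∷ mid ++ P' ∷ ys) → All R (xs ++ P ∷ ys)
  window-All xs rs with ++⁻ xs rs
  ... | rxs , rP ∷ rrest with ++⁻ʳ mid rrest
  ...   | _ ∷ rys = ++⁺ rxs (rP ∷ rys)

size-catL : ∀ h t → size (catL h t) ≡ size h + sizes t
size-catL h [] = sym (ℕ.+-identityʳ (size h))
size-catL h (y ∷ ys) = cong (size h +_) (size-catL y ys)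

size-Qsnoc : ∀ w x → size (Qsnoc w x) ≡ suc (sizes (w ++ [ x ]))
size-Qsnoc [] x = refl
size-Qsnoc (y ∷ ys) x = refl

size-last≤ : ∀ w x → size x ≤ sizes (w ++ [ x ])
size-last≤ w x = subst (_≤ sizes (w ++ [ x ])) (ℕ.+-identityʳ (size x)) (sizes-++-≤ʳ w [ x ])

Q<FormI : ∀ u₀ us x → size (Q u₀ us) < size (Qsnoc (u₀ ∷ us) x)
Q<FormI u₀ us x = s≤s (ℕ.+-monoʳ-< (size u₀) sizes<)
  where
  sizes< : sizes us < sizes (us ++ [ x ])
  sizes< = subst (sizes us <_) (sym (sizes-++ us [ x ]))
                 (ℕ.m<m+n (sizes us) (ℕ.≤-trans (size-positive x) (ℕ.m≤m+n (size x) 0)))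

FormII-argument : ∀ u₀ us (τ₀ τ₁ : Maybe (Fin (suc (length us)))) → Term
FormII-argument u₀ us τ₀ τ₁ = (pick (u₀ ∷ us) τ₀ ⌢? Q u₀ us) ?⌢ pick (u₀ ∷ us) τ₁

Q≤FormII-argument : ∀ u₀ us τ₀ τ₁ → size (Q u₀ us) ≤ size (FormII-argument u₀ us τ₀ τ₁)
Q≤FormII-argument u₀ us nothing nothing = ℕ.≤-refl
Q≤FormII-argument u₀ us (just a) nothing = ℕ.m≤n+m _ _
Q≤FormII-argument u₀ us nothing (just b) = ℕ.m≤m+n _ _
Q≤FormII-argument u₀ us (just a) (just b) =
  ℕ.≤-trans (ℕ.m≤n+m _ (size (lookup (u₀ ∷ us) a))) (ℕ.m≤m+n _ _)

Q<FormII : ∀ u₀ us k τ₀ τ₁ → size (Q u₀ us) < size (Qsnoc (take k (u₀ ∷ us)) (FormII-argument u₀ us τ₀ τ₁))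
Q<FormII u₀ us k τ₀ τ₁ =
  subst (size (Q u₀ us) <_) (sym (size-Qsnoc (take k (u₀ ∷ us)) _))
        (s≤s (ℕ.≤-trans (Q≤FormII-argument u₀ us τ₀ τ₁) (size-last≤ (take k (u₀ ∷ us)) _)))

range : (ℕ → Term) → ℕ → ℕ → List Term
range a s zero = a s ∷ []
range a s (suc l) = a s ∷ range a (suc s) l

range-All : ∀ {R : Term → Set} {a} → (∀ n → R (a n)) → ∀ s l → All R (range a s l)
range-All Ra s zero = Ra s ∷ []
range-All Ra s (suc l) = Ra s ∷ range-All Ra (suc s) l

range-Any : ∀ {R : Term → Set} {a} s {l d} → d ≤ l → R (a (s + d)) → Any R (range a s l)
range-Any {R} {a} s {zero} {zero} _ Ra = here (subst (λ k → R (a k)) (ℕ.+-identityʳ s) Ra)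
range-Any {R} {a} s {suc _} {zero} _ Ra = here (subst (λ k → R (a k)) (ℕ.+-identityʳ s) Ra)
range-Any {R} {a} s {suc l} {suc d} (s≤s d≤l) Ra =
  there (range-Any (suc s) d≤l (subst (λ k → R (a k)) (ℕ.+-suc s d) Ra))

range-head : ∀ a s l → Σ (List Term) λ r → range a s l ≡ a s ∷ r
range-head a s zero = [] , refl
range-head a s (suc l) = range a (suc s) l , refl

-- Semantics of terms

module TermSemantics (Qs : (n : ℕ) → DenseColoured (suc n)) where
  open Semantics Qs

  shuffleOrder : ∀ n → DenseColouredOrder (Fin (suc n))
  shuffleOrder n = record
    { countable = record
      { Carrier = Q.Car ; _≺_ = Q._<_ ; irrefl = Q.irrefl refl ; ≺-trans = Q.trans
      ; trichotomy = λ x y → Tri⇒⊎ (Q.compare x y) ; enum = Q.enum ; enum-surj = Q.enum-surj }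
    ; colour = Q.colour ; point = Q.point ; noMin = Q.noMin ; noMax = Q.noMax ; dense = Q.denseCol }
    where
    module Q where
      open DenseColoured (Qs n) public
      open IsStrictTotalOrder isSTO public

  arg-lookup : ∀ t ts i → arg t ts i ≡ ⟦ lookup (t ∷ ts) i ⟧
  arg-lookup t ts zero = refl
  arg-lookup t (u ∷ us) (suc i) = arg-lookup u us i

  ⟦Q⟧≅shuffle : ∀ t ts →
                ⟦ Q t ts ⟧ ≅ shuffleLO (shuffleOrder (length ts)) (λ i → ⟦ lookup (t ∷ ts) i ⟧)
  ⟦Q⟧≅shuffle t ts = ΣLO-congʳ (λ q → ≡⇒≅ (arg-lookup t ts (DenseColoured.colour (Qs (length ts)) q)))

  Q-cong : ∀ {t ts t' ts'} (π : Fin (suc (length ts)) → Fin (suc (length ts'))) → (∀ i' → Σ _ λ i → π i ≡ i') →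
           (∀ i → ⟦ lookup (t ∷ ts) i ⟧ ≅ ⟦ lookup (t' ∷ ts') (π i) ⟧) → ⟦ Q t ts ⟧ ≅ ⟦ Q t' ts' ⟧
  Q-cong {t} {ts} {t'} {ts'} π π-surj args≅ =
    ≅-trans (⟦Q⟧≅shuffle t ts)
            (≅-trans (shuffleLO-merge (shuffleOrder _) (shuffleOrder _) (λ i → ⟦ lookup (t' ∷ ts') i ⟧) π π-surj args≅)
                     (≅-sym (⟦Q⟧≅shuffle t' ts')))

  mutual
    ⟦⟧-resp-≈ : ∀ {a b} → a ≈ₜ b → ⟦ a ⟧ ≅ ⟦ b ⟧
    ⟦⟧-resp-≈ ≈-refl = ≅-refl
    ⟦⟧-resp-≈ (≈-sym p) = ≅-sym (⟦⟧-resp-≈ p)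
    ⟦⟧-resp-≈ (≈-trans p q) = ≅-trans (⟦⟧-resp-≈ p) (⟦⟧-resp-≈ q)
    ⟦⟧-resp-≈ ≈-assoc = sumLO-assoc
    ⟦⟧-resp-≈ (≈-⌢ p q) = sumLO-cong (⟦⟧-resp-≈ p) (⟦⟧-resp-≈ q)
    ⟦⟧-resp-≈ (≈-Q pw) =
      Q-cong (Fin.cast (Pointwise-length pw)) (cast-surj (Pointwise-length pw)) (lookup-resp-≈ pw)
    ⟦⟧-resp-≈ (≈-perm p) =
      let π = onIndices (↭⇒↭ₛ p) in
      Q-cong (π ⟨$⟩ʳ_) (λ i' → π ⟨$⟩ˡ i' , inverseʳ π)
             (λ i → ≡⇒≅ (cong ⟦_⟧ (↭ₛ.onIndices-lookup (setoid Term) (↭⇒↭ₛ p) i)))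

    lookup-resp-≈ : ∀ {xs ys} (pw : Pointwise _≈ₜ_ xs ys) i →
                    ⟦ lookup xs i ⟧ ≅ ⟦ lookup ys (Fin.cast (Pointwise-length pw) i) ⟧
    lookup-resp-≈ (p ∷ _) zero = ⟦⟧-resp-≈ p
    lookup-resp-≈ (_ ∷ pw) (suc i) = lookup-resp-≈ pw i

  Q-idem : ∀ t ts → sumLO ⟦ Q t ts ⟧ ⟦ Q t ts ⟧ ≅ ⟦ Q t ts ⟧
  Q-idem t ts = shuffleLO-idem (shuffleOrder (length ts)) (arg t ts)

  Q-absorb : ∀ t ts j → sumLO ⟦ Q t ts ⟧ (sumLO ⟦ lookup (t ∷ ts) j ⟧ ⟦ Q t ts ⟧) ≅ ⟦ Q t ts ⟧
  Q-absorb t ts j =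
    subst (λ A → sumLO ⟦ Q t ts ⟧ (sumLO A ⟦ Q t ts ⟧) ≅ ⟦ Q t ts ⟧) (arg-lookup t ts j)
          (shuffleLO-absorb (shuffleOrder (length ts)) (arg t ts) j)

  Q-ω : ∀ t ts → ΣLO ℕ _<_ (λ _ → ⟦ Q t ts ⟧) ≅ ⟦ Q t ts ⟧
  Q-ω t ts = shuffleLO-ω (shuffleOrder (length ts)) (arg t ts)

  Qsnoc≅shuffle : ∀ w x → Σ (DenseColouredOrder (Fin (length (w ++ [ x ])))) λ E →
                  ⟦ Qsnoc w x ⟧ ≅ shuffleLO E (λ i → ⟦ lookup (w ++ [ x ]) i ⟧)
  Qsnoc≅shuffle [] x = shuffleOrder 0 , ⟦Q⟧≅shuffle x []
  Qsnoc≅shuffle (y ∷ ys) x = shuffleOrder (length (ys ++ [ x ])) , ⟦Q⟧≅shuffle y (ys ++ [ x ])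

  FormI-collapse : ∀ u₀ us j → ⟦ Qsnoc (u₀ ∷ us) (lookup (u₀ ∷ us) j) ⟧ ≅ ⟦ Q u₀ us ⟧
  FormI-collapse u₀ us j =
    let E , ⟦Qsnoc⟧≅ = Qsnoc≅shuffle u x in
    ≅-trans ⟦Qsnoc⟧≅ (≅-trans (shuffleLO-merge E (shuffleOrder (length us)) (λ i → ⟦ lookup u i ⟧) π π-surj args≅)
                              (≅-sym (⟦Q⟧≅shuffle u₀ us)))
    where
    u = u₀ ∷ us
    x = lookup u j
    π : Fin (length (u ++ [ x ])) → Fin (length u)
    π i = Maybe.fromMaybe j (init-or-last u x i)
    π-surj : ∀ c → Σ _ λ i → π i ≡ c
    π-surj c = let i , e = init-or-last-surj u x c in i , cong (Maybe.fromMaybe j) e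
    args≅ : ∀ i → ⟦ lookup (u ++ [ x ]) i ⟧ ≅ ⟦ lookup u (π i) ⟧
    args≅ i with init-or-last u x i in e
    ... | just c = ≡⇒≅ (cong ⟦_⟧ (lookup-init u x i e))
    ... | nothing = ≡⇒≅ (cong ⟦_⟧ (lookup-last u x i e))

  module FormII (u₀ : Term) (us : List Term) (τ₀ τ₁ : Maybe (Fin (suc (length us)))) where
    private
      u = u₀ ∷ us
      C = Fin (suc (length us))
      F : C → LO
      F = arg u₀ us
      E = shuffleOrder (length us)

      point≅ : ∀ c → ⟦ lookup u c ⟧ ≅ pieceLO F (point c)
      point≅ c = ≅-sym (≅-trans (pieceLO-point F c) (≡⇒≅ (arg-lookup u₀ us c)))

      X = FormII-argument u₀ us τ₀ τ₁

      -- X is the row  τ₀ · E · τ₁  of (at most two) points around a dense piece.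
      Xwidth : Maybe C → Maybe C → ℕ
      Xwidth nothing nothing = 0
      Xwidth (just _) nothing = 1
      Xwidth nothing (just _) = 1
      Xwidth (just _) (just _) = 2

      Xrow : ∀ σ₀ σ₁ → Fin (suc (Xwidth σ₀ σ₁)) → Piece C
      Xrow nothing nothing _ = dense E
      Xrow (just a) nothing zero = point a
      Xrow (just a) nothing (suc _) = dense E
      Xrow nothing (just b) zero = dense E
      Xrow nothing (just b) (suc _) = point b
      Xrow (just a) (just b) zero = point a
      Xrow (just a) (just b) (suc zero) = dense E
      Xrow (just a) (just b) (suc (suc _)) = point b

      Xrow-separated : ∀ σ₀ σ₁ {a a'} → IsPoint (Xrow σ₀ σ₁ a) → IsPoint (Xrow σ₀ σ₁ a') → a Fin.< a' →
                       Σ (Fin (suc (Xwidth σ₀ σ₁))) λ m → IsDense (Xrow σ₀ σ₁ m) × a Fin.< m × m Fin.< a'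
      Xrow-separated (just _) nothing {zero} {zero} _ _ ()
      Xrow-separated nothing (just _) {suc zero} {suc zero} _ _ (s≤s ())
      Xrow-separated (just _) (just _) {zero} {zero} _ _ ()
      Xrow-separated (just _) (just _) {zero} {suc (suc zero)} _ _ _ = suc zero , tt , s≤s z≤n , s≤s (s≤s z≤n)
      Xrow-separated (just _) (just _) {suc (suc zero)} {suc (suc zero)} _ _ (s≤s (s≤s ()))

      Xrow-dense : ∀ σ₀ σ₁ → Σ (Fin (suc (Xwidth σ₀ σ₁))) λ a → IsDense (Xrow σ₀ σ₁ a)
      Xrow-dense nothing nothing = zero , tt
      Xrow-dense (just _) nothing = suc zero , tt
      Xrow-dense nothing (just _) = zero , tt
      Xrow-dense (just _) (just _) = suc zero , tt

      X≅row : ∀ σ₀ σ₁ → ⟦ FormII-argument u₀ us σ₀ σ₁ ⟧ ≅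
                        ΣLO (Fin (suc (Xwidth σ₀ σ₁))) Fin._<_ (λ a → pieceLO F (Xrow σ₀ σ₁ a))
      X≅row nothing nothing = ≅-sym (ΣLO-Fin1 _)
      X≅row (just a) nothing = ≅-trans (sumLO-cong (point≅ a) ≅-refl) (≅-sym (ΣLO-Fin2 _))
      X≅row nothing (just b) = ≅-trans (sumLO-cong ≅-refl (point≅ b)) (≅-sym (ΣLO-Fin2 _))
      X≅row (just a) (just b) =
        ≅-trans sumLO-assoc
                (≅-trans (sumLO-cong (point≅ a) (sumLO-cong ≅-refl (point≅ b))) (≅-sym (ΣLO-Fin3 _)))

    module _ (k : ℕ) where
      private
        w = take k u

        width : Maybe (Fin (length w)) → ℕ
        width (just _) = 0
        width nothing = Xwidth τ₀ τ₁

        row : (m : Maybe (Fin (length w))) → Fin (suc (width m)) → Piece C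
        row (just j) _ = point (take-index k u j)
        row nothing = Xrow τ₀ τ₁

        row-separated : ∀ m {a a'} → IsPoint (row m a) → IsPoint (row m a') → a Fin.< a' →
                        Σ (Fin (suc (width m))) λ b → IsDense (row m b) × a Fin.< b × b Fin.< a'
        row-separated (just _) {zero} {zero} _ _ ()
        row-separated nothing = Xrow-separated τ₀ τ₁

        colourRow : Fin (length (w ++ [ X ])) → Maybe (Fin (length w))
        colourRow = init-or-last w X

        dense-row : Σ (Fin (length (w ++ [ X ]))) λ i →
                    Σ (Fin (suc (width (colourRow i)))) λ a → IsDense (row (colourRow i) a)
        dense-row = let i , e = last-index w X in
          i , subst (λ m → Σ (Fin (suc (width m))) λ a → IsDense (row m a)) (sym e) (Xrow-dense τ₀ τ₁)

        arg≅row : ∀ i m → colourRow i ≡ m →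
                  ⟦ lookup (w ++ [ X ]) i ⟧ ≅ ΣLO (Fin (suc (width m))) Fin._<_ (λ a → pieceLO F (row m a))
        arg≅row i (just j) e = begin
          ⟦ lookup (w ++ [ X ]) i ⟧             ≡⟨ cong ⟦_⟧ (trans (lookup-init w X i e) (lookup-take k u j)) ⟩
          ⟦ lookup u (take-index k u j) ⟧       ≅⟨ point≅ (take-index k u j) ⟩
          pieceLO F (point (take-index k u j))  ≅⟨ ΣLO-Fin1 _ ⟨
          _                                     ∎
        arg≅row i nothing e = ≅-trans (≡⇒≅ (cong ⟦_⟧ (lookup-last w X i e))) (X≅row τ₀ τ₁)

        open Substitution (proj₁ (Qsnoc≅shuffle w X)) (λ i → width (colourRow i)) (λ i → row (colourRow i))
                          (λ i → row-separated (colourRow i)) (proj₁ dense-row) (proj₁ (proj₂ dense-row))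
                          (proj₂ (proj₂ dense-row))

      FormII-collapse : ⟦ Qsnoc (take k u) X ⟧ ≅ ⟦ Q u₀ us ⟧
      FormII-collapse = begin
        ⟦ Qsnoc w X ⟧                                            ≅⟨ proj₂ (Qsnoc≅shuffle w X) ⟩
        shuffleLO E' (λ i → ⟦ lookup (w ++ [ X ]) i ⟧)           ≅⟨ ΣLO-congʳ (λ q → arg≅row _ _ refl) ⟩
        _                                                        ≅⟨ substitution F E ⟩
        ⟦ Q u₀ us ⟧                                              ∎
        where E' = proj₁ (Qsnoc≅shuffle w X)

  open FormII public using (FormII-collapse)

  listLO : List Term → LO
  listLO [] = emptyLO
  listLO (x ∷ xs) = sumLO ⟦ x ⟧ (listLO xs)

  listLO-++ : ∀ xs ys → listLO (xs ++ ys) ≅ sumLO (listLO xs) (listLO ys)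
  listLO-++ [] ys = ≅-sym (sumLO-identityˡ _)
  listLO-++ (x ∷ xs) ys = ≅-trans (sumLO-cong ≅-refl (listLO-++ xs ys)) (≅-sym sumLO-assoc)

  ⟦catL⟧≅listLO : ∀ h t → ⟦ catL h t ⟧ ≅ listLO (h ∷ t)
  ⟦catL⟧≅listLO h [] = ≅-sym (sumLO-identityʳ _)
  ⟦catL⟧≅listLO h (y ∷ ys) = sumLO-cong ≅-refl (⟦catL⟧≅listLO y ys)

  one-finite : Finite one
  one-finite = 1 , record
    { to = λ _ → zero ; from = λ _ → tt ; from-to = λ _ → refl ; to-from = λ { zero → refl }
    ; mono = λ () ; refl< = λ { {tt} {tt} () } }

  Atom : Term → Set
  Atom a = NF a × (a ≡ one ⊎ IsQ a)

  Atom-¬IsQ⇒one : ∀ {x} → Atom x → ¬ IsQ x → x ≡ one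
  Atom-¬IsQ⇒one (_ , inj₁ x≡one) _ = x≡one
  Atom-¬IsQ⇒one (_ , inj₂ isQ) ¬isQ = ⊥-elim (¬isQ isQ)

  Atom-≈Q⇒IsQ : ∀ {P t ts} → Atom P → P ≈ₜ Q t ts → IsQ P
  Atom-≈Q⇒IsQ (_ , inj₁ refl) P≈ = ⊥-elim (one≉Q P≈)
  Atom-≈Q⇒IsQ (_ , inj₂ isQ) _ = isQ

  factors-catL : ∀ {h t} → All Atom (h ∷ t) → factors (catL h t) ≡ h ∷ t
  factors-catL {t = []} ((_ , inj₁ refl) ∷ []) = refl
  factors-catL {t = []} ((_ , inj₂ (_ , _ , refl)) ∷ []) = refl
  factors-catL {t = y ∷ ys} ((_ , inj₁ refl) ∷ as) = cong (one ∷_) (factors-catL as)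
  factors-catL {t = y ∷ ys} ((_ , inj₂ (_ , _ , refl)) ∷ as) = cong (_ ∷_) (factors-catL as)

  NF-catL : ∀ {h t} → All Atom (h ∷ t) → ¬ BadFactors (h ∷ t) → NF (catL h t)
  NF-catL {t = []} (a ∷ []) _ = proj₁ a
  NF-catL {t = _ ∷ _} as ¬bad =
    nf-⌢ (subst (All NF) (sym e) (All.map proj₁ as)) (λ bad → ¬bad (subst BadFactors e bad))
    where e = factors-catL as

  bad-window≅ : ∀ {P P' t ts} mid → P ≈ₜ Q t ts → P' ≈ₜ Q t ts →
                (mid ≡ [] ⊎ Σ Term λ m → Σ (List Term) λ ms → mid ≡ m ∷ ms × Any (catL m ms ≈ₜ_) (t ∷ ts)) →
                sumLO ⟦ P ⟧ (sumLO (listLO mid) ⟦ P' ⟧) ≅ ⟦ P ⟧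
  bad-window≅ {P} {P'} {t} {ts} _ P≈ P'≈ (inj₁ refl) = begin
    sumLO ⟦ P ⟧ (sumLO emptyLO ⟦ P' ⟧)
      ≅⟨ sumLO-cong (⟦⟧-resp-≈ P≈) (≅-trans (sumLO-identityˡ _) (⟦⟧-resp-≈ P'≈)) ⟩
    sumLO ⟦ Q t ts ⟧ ⟦ Q t ts ⟧         ≅⟨ Q-idem t ts ⟩
    ⟦ Q t ts ⟧                          ≅⟨ ⟦⟧-resp-≈ P≈ ⟨
    ⟦ P ⟧                               ∎
  bad-window≅ {P} {P'} {t} {ts} _ P≈ P'≈ (inj₂ (m , ms , refl , mid≈arg)) = begin
    sumLO ⟦ P ⟧ (sumLO (listLO (m ∷ ms)) ⟦ P' ⟧)
      ≅⟨ sumLO-cong (⟦⟧-resp-≈ P≈) (sumLO-cong mid≅ (⟦⟧-resp-≈ P'≈)) ⟩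
    sumLO ⟦ Q t ts ⟧ (sumLO ⟦ lookup (t ∷ ts) j ⟧ ⟦ Q t ts ⟧)
      ≅⟨ Q-absorb t ts j ⟩
    ⟦ Q t ts ⟧
      ≅⟨ ⟦⟧-resp-≈ P≈ ⟨
    ⟦ P ⟧ ∎
    where
    j = Any.index mid≈arg
    mid≅ : listLO (m ∷ ms) ≅ ⟦ lookup (t ∷ ts) j ⟧
    mid≅ = ≅-trans (≅-sym (⟦catL⟧≅listLO m ms)) (⟦⟧-resp-≈ (lookup-index mid≈arg))

  remove-window≅ : ∀ xs P mid P' ys → sumLO ⟦ P ⟧ (sumLO (listLO mid) ⟦ P' ⟧) ≅ ⟦ P ⟧ →
                   listLO (xs ++ P ∷ mid ++ P' ∷ ys) ≅ listLO (xs ++ P ∷ ys)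
  remove-window≅ xs P mid P' ys window≅ = begin
    listLO (xs ++ P ∷ mid ++ P' ∷ ys)                               ≅⟨ listLO-++ xs _ ⟩
    sumLO (listLO xs) (sumLO ⟦ P ⟧ (listLO (mid ++ P' ∷ ys)))       ≅⟨ sumLO-cong ≅-refl inner ⟩
    sumLO (listLO xs) (sumLO ⟦ P ⟧ (listLO ys))                     ≅⟨ listLO-++ xs _ ⟨
    listLO (xs ++ P ∷ ys)                                           ∎
    where
    inner : sumLO ⟦ P ⟧ (listLO (mid ++ P' ∷ ys)) ≅ sumLO ⟦ P ⟧ (listLO ys)
    inner = begin
      sumLO ⟦ P ⟧ (listLO (mid ++ P' ∷ ys))                       ≅⟨ sumLO-cong ≅-refl (listLO-++ mid _) ⟩
      sumLO ⟦ P ⟧ (sumLO (listLO mid) (sumLO ⟦ P' ⟧ (listLO ys)))  ≅⟨ sumLO-cong ≅-refl sumLO-assoc ⟨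
      sumLO ⟦ P ⟧ (sumLO (sumLO (listLO mid) ⟦ P' ⟧) (listLO ys))  ≅⟨ sumLO-assoc ⟨
      sumLO (sumLO ⟦ P ⟧ (sumLO (listLO mid) ⟦ P' ⟧)) (listLO ys)  ≅⟨ sumLO-cong window≅ ≅-refl ⟩
      sumLO ⟦ P ⟧ (listLO ys)                                     ∎

  mutual
    element : ∀ t → Car ⟦ t ⟧
    element one = tt
    element (a ⌢ b) = inj₁ (element a)
    element (Q t ts) = q , arg-element t ts (DenseColoured.colour (Qs (length ts)) q)
      where q = DenseColoured.point (Qs (length ts))

    arg-element : ∀ t ts i → Car (arg t ts i)
    arg-element t ts zero = element t
    arg-element t (u ∷ us) (suc i) = arg-element u us i

  HasQ⇒ascending : ∀ {L} → HasQ L → AscendingChain (listLO L)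
  HasQ⇒ascending (here (t , ts , refl)) =
    AscendingChain-sumLOˡ (shuffleLO-ascending (shuffleOrder (length ts)) (arg t ts) (arg-element t ts))
  HasQ⇒ascending (there has) = AscendingChain-sumLOʳ (HasQ⇒ascending has)

  HasQ⇒infinite : ∀ {h t} → HasQ (h ∷ t) → Infinite (catL h t)
  HasQ⇒infinite {h} {t} has (m , φ) =
    AscendingChain⇒¬finite (AscendingChain-≅ (≅-sym (⟦catL⟧≅listLO h t)) (HasQ⇒ascending has)) m φ

  listLO≅ΣLO-lookup : ∀ h t → listLO (h ∷ t) ≅ ΣLO (Fin (suc (length t))) Fin._<_ (λ k → ⟦ lookup (h ∷ t) k ⟧)
  listLO≅ΣLO-lookup h [] = ≅-trans (sumLO-identityʳ _) (≅-sym (ΣLO-Fin1 _))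
  listLO≅ΣLO-lookup h (y ∷ ys) =
    ≅-trans (sumLO-cong ≅-refl (listLO≅ΣLO-lookup y ys)) (≅-sym (ΣLO-Fin-suc _ _))

  blockLO≅range : ∀ a s l → blockLO (λ n → ⟦ a n ⟧) s l ≅ listLO (range a s l)
  blockLO≅range a s zero = ≅-trans (blockLO-zero (λ n → ⟦ a n ⟧) s) (≅-sym (sumLO-identityʳ _))
  blockLO≅range a s (suc l) =
    ≅-trans (blockLO-suc (λ n → ⟦ a n ⟧) s l) (sumLO-cong ≅-refl (blockLO≅range a (suc s) l))

-- Normal forms of terms

module Normalisation (Qs : (n : ℕ) → DenseColoured (suc n)) (em : ∀ {ℓ} → ExcludedMiddle ℓ) where
  open Semantics Qs
  open TermSemantics Qs

  record Reduct (L : List Term) : Set where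
    field
      list       : List Term
      atoms      : All Atom list
      no-bad     : ¬ BadFactors list
      ≅list      : listLO L ≅ listLO list
      sizes≤     : sizes list ≤ sizes L
      keeps-Q    : HasQ L → HasQ list
      keeps-head : ∀ {h t} → L ≡ h ∷ t → Σ (List Term) λ t' → list ≡ h ∷ t'

  -- Bad windows are removed one at a time; each removal shortens the list, which bounds the recursion.
  reduce : ∀ n L → length L ≤ n → All Atom L → Reduct L
  reduce n L _ atoms with em {P = BadFactors L}
  ... | no ¬bad = record
    { list = L ; atoms = atoms ; no-bad = ¬bad ; ≅list = ≅-refl ; sizes≤ = ℕ.≤-refl
    ; keeps-Q = λ q → q ; keeps-head = λ e → _ , e }
  reduce zero L L≤0 _ | yes (xs , ys , P , P' , mid , _ , _ , refl , _) =
    ⊥-elim (ℕ.n≮0 (ℕ.<-≤-trans (window-length P mid P' ys xs) L≤0))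
  reduce (suc n) L L≤ atoms | yes (xs , ys , P , P' , mid , t , ts , refl , P≈ , P'≈ , mid-arg) = record
    { list = R.list ; atoms = R.atoms ; no-bad = R.no-bad
    ; ≅list = ≅-trans (remove-window≅ xs P mid P' ys (bad-window≅ mid P≈ P'≈ mid-arg)) R.≅list
    ; sizes≤ = ℕ.≤-trans R.sizes≤ (window-sizes P mid P' ys xs)
    ; keeps-Q = λ _ → R.keeps-Q (++⁺ʳ xs (here (Atom-≈Q⇒IsQ P-atom P≈)))
    ; keeps-head = λ e → R.keeps-head (proj₂ (window-head P mid P' ys xs e)) }
    where
    P-atom : Atom P
    P-atom = All.lookup atoms (∈-++⁺ʳ xs (here refl))
    module R = Reduct (reduce n (xs ++ P ∷ ys) (ℕ.≤-pred (ℕ.<-≤-trans (window-length P mid P' ys xs) L≤))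
                              (window-All P mid P' ys xs atoms))

  record NormalShuffle (t : Term) : Set where
    field
      term  : Term
      isQ   : IsQ term
      nf    : NF term
      ≅term : ⟦ t ⟧ ≅ ⟦ term ⟧
      size≤ : size term ≤ size t

  NormalShuffle-transport : ∀ {t t'} → ⟦ t ⟧ ≅ ⟦ t' ⟧ → size t' ≤ size t → NormalShuffle t' → NormalShuffle t
  NormalShuffle-transport t≅t' t'≤t s = record
    { term = S.term ; isQ = S.isQ ; nf = S.nf
    ; ≅term = ≅-trans t≅t' S.≅term ; size≤ = ℕ.≤-trans S.size≤ t'≤t }
    where module S = NormalShuffle s

  record Word (t : Term) : Set where
    field
      head   : Term
      tail   : List Term
      atoms  : All Atom (head ∷ tail)
      no-bad : ¬ BadFactors (head ∷ tail)
      ≅word  : ⟦ t ⟧ ≅ listLO (head ∷ tail)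
      sizes≤ : sizes (head ∷ tail) ≤ size t

  Word-one : Word one
  Word-one = record
    { head = one ; tail = [] ; atoms = (nf-fin one-finite , inj₁ refl) ∷ [] ; no-bad = singleton-¬BadFactors one
    ; ≅word = ≅-sym (sumLO-identityʳ _) ; sizes≤ = ℕ.≤-refl }

  Word-shuffle : ∀ {t} → NormalShuffle t → Word t
  Word-shuffle {t} s = record
    { head = S.term ; tail = [] ; atoms = (S.nf , inj₂ S.isQ) ∷ [] ; no-bad = singleton-¬BadFactors S.term
    ; ≅word = ≅-trans S.≅term (≅-sym (sumLO-identityʳ _))
    ; sizes≤ = subst (_≤ size t) (sym (ℕ.+-identityʳ (size S.term))) S.size≤ }
    where module S = NormalShuffle s

  Word-⌢ : ∀ {a b} → Word a → Word b → Word (a ⌢ b)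
  Word-⌢ {a} {b} A B = record
    { head = A.head ; tail = proj₁ head-kept
    ; atoms = subst (All Atom) (proj₂ head-kept) R.atoms
    ; no-bad = subst (λ L → ¬ BadFactors L) (proj₂ head-kept) R.no-bad
    ; ≅word = begin
        sumLO ⟦ a ⟧ ⟦ b ⟧                                   ≅⟨ sumLO-cong A.≅word B.≅word ⟩
        sumLO (listLO (A.head ∷ A.tail)) (listLO (B.head ∷ B.tail))  ≅⟨ listLO-++ (A.head ∷ A.tail) _ ⟨
        listLO L                                            ≅⟨ R.≅list ⟩
        listLO R.list                                       ≡⟨ cong listLO (proj₂ head-kept) ⟩
        _                                                   ∎
    ; sizes≤ = subst (_≤ size a + size b) (cong sizes (proj₂ head-kept))
                 (ℕ.≤-trans R.sizes≤ (subst (_≤ size a + size b) (sym (sizes-++ (A.head ∷ A.tail) _))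
                                            (ℕ.+-mono-≤ A.sizes≤ B.sizes≤))) }
    where
    module A = Word A
    module B = Word B
    L = (A.head ∷ A.tail) ++ (B.head ∷ B.tail)
    module R = Reduct (reduce (length L) L ℕ.≤-refl (++⁺ A.atoms B.atoms))
    head-kept = R.keeps-head refl

  record NormalArgs (xs : List Term) : Set where
    field
      args   : List Term
      ≅args  : Pointwise (λ x y → ⟦ x ⟧ ≅ ⟦ y ⟧) xs args
      nf     : All NF args
      sizes≤ : sizes args ≤ sizes xs

  mutual
    word : ∀ n t → size t ≤ n → Word t
    word zero t t≤0 = ⊥-elim (ℕ.n≮0 (ℕ.<-≤-trans (size-positive t) t≤0))
    word (suc n) one _ = Word-one
    word (suc n) (a ⌢ b) ab≤ =
      Word-⌢ (word n a (ℕ.≤-pred (ℕ.<-≤-trans (ℕ.m<m+n (size a) (size-positive b)) ab≤)))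
             (word n b (ℕ.≤-pred (ℕ.<-≤-trans (ℕ.m<n+m (size b) (size-positive a)) ab≤)))
    word (suc n) (Q t ts) Q≤ = Word-shuffle (normalShuffle (suc n) t ts Q≤)

    normalArgs : ∀ n xs → sizes xs ≤ n → NormalArgs xs
    normalArgs n [] _ = record { args = [] ; ≅args = [] ; nf = [] ; sizes≤ = z≤n }
    normalArgs n (x ∷ xs) le = record
      { args = catL W.head W.tail ∷ R.args
      ; ≅args = ≅-trans W.≅word (≅-sym (⟦catL⟧≅listLO W.head W.tail)) ∷ R.≅args
      ; nf = NF-catL W.atoms W.no-bad ∷ R.nf
      ; sizes≤ = ℕ.+-mono-≤ (subst (_≤ size x) (sym (size-catL W.head W.tail)) W.sizes≤) R.sizes≤ }
      where
      module W = Word (word n x (ℕ.≤-trans (ℕ.m≤m+n (size x) (sizes xs)) le))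
      module R = NormalArgs (normalArgs n xs (ℕ.≤-trans (ℕ.m≤n+m (sizes xs) (size x)) le))

    normalShuffle : ∀ n t ts → size (Q t ts) ≤ n → NormalShuffle (Q t ts)
    normalShuffle (suc n) t ts Q≤ with normalArgs n (t ∷ ts) (ℕ.≤-pred Q≤)
    ... | record { args = t' ∷ ts' ; ≅args = ≅args ; nf = nf ; sizes≤ = sizes≤ } =
      NormalShuffle-transport
        (Q-cong (Fin.cast (Pointwise-length ≅args)) (cast-surj (Pointwise-length ≅args))
                (Pointwise.lookup-cast ≅args (Pointwise-length ≅args)))
        (s≤s sizes≤)
        (normalShuffle-NF-args n t' ts' (ℕ.≤-trans (s≤s sizes≤) Q≤) nf)

    -- Once the arguments are normal, a shuffle fails to be normal only through Form (i) or (ii),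
    -- and collapsing either form strictly decreases the size.
    normalShuffle-NF-args : ∀ n t ts → size (Q t ts) ≤ suc n → All NF (t ∷ ts) → NormalShuffle (Q t ts)
    normalShuffle-NF-args n t ts Q≤ nfs with em {P = NF (Q t ts)}
    ... | yes nf = record { term = Q t ts ; isQ = t , ts , refl ; nf = nf ; ≅term = ≅-refl ; size≤ = ℕ.≤-refl }
    ... | no ¬nf with em {P = FormI (Q t ts)}
    ...   | yes ([] , () , _)
    ...   | yes (u₀ ∷ us , j , e) =
      normalShuffle-via n Q≤ u₀ us (≅-trans (⟦⟧-resp-≈ e) (FormI-collapse u₀ us j))
                                   (subst (size (Q u₀ us) <_) (sym (size-resp-≈ e)) (Q<FormI u₀ us (lookup (u₀ ∷ us) j)))
    ...   | no ¬I with em {P = FormII (Q t ts)}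
    ...     | yes (u₀ , us , k , τ₀ , τ₁ , _ , e) =
      normalShuffle-via n Q≤ u₀ us (≅-trans (⟦⟧-resp-≈ e) (FormII-collapse u₀ us τ₀ τ₁ k))
                                   (subst (size (Q u₀ us) <_) (sym (size-resp-≈ e)) (Q<FormII u₀ us k τ₀ τ₁))
    ...     | no ¬II = ⊥-elim (¬nf (nf-Q nfs ¬I ¬II))

    normalShuffle-via : ∀ n {s} → size s ≤ suc n → ∀ u₀ us → ⟦ s ⟧ ≅ ⟦ Q u₀ us ⟧ →
                        size (Q u₀ us) < size s → NormalShuffle s
    normalShuffle-via n s≤ u₀ us s≅ Q< =
      NormalShuffle-transport s≅ (ℕ.<⇒≤ Q<) (normalShuffle n u₀ us (ℕ.≤-pred (ℕ.<-≤-trans Q< s≤)))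

-- Normal forms of sequences

module NormalSequences (Qs : (n : ℕ) → DenseColoured (suc n)) (em : ∀ {ℓ} → ExcludedMiddle ℓ) where
  open Semantics Qs
  open TermSemantics Qs
  open Normalisation Qs em

  record Concatenation (L : List Term) : Set where
    field
      term       : Term
      nf         : NF term
      infinite   : Infinite term
      ≅term      : listLO L ≅ ⟦ term ⟧
      cat-if-one : ∀ {r} → L ≡ one ∷ r → IsCat term

  concatenation : ∀ {L} → All Atom L → HasQ L → Concatenation L
  concatenation {h ∷ t} atoms has = record
    { term = catL h t'
    ; nf = NF-catL (subst (All Atom) e R.atoms) (subst (λ L → ¬ BadFactors L) e R.no-bad)
    ; infinite = HasQ⇒infinite has'
    ; ≅term = ≅-trans R.≅list (≅-trans (≡⇒≅ (cong listLO e)) (≅-sym (⟦catL⟧≅listLO h t')))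
    ; cat-if-one = λ { refl → cat has' } }
    where
    module R = Reduct (reduce (length (h ∷ t)) (h ∷ t) ℕ.≤-refl atoms)
    t' = proj₁ (R.keeps-head refl)
    e = proj₂ (R.keeps-head refl)
    has' : HasQ (h ∷ t')
    has' = subst HasQ e (R.keeps-Q has)
    cat : ∀ {t'} → HasQ (one ∷ t') → IsCat (catL one t')
    cat (here (_ , _ , ()))
    cat {y ∷ ys} (there _) = one , catL y ys , refl

  module Atomise (t : ℕ → Term) where
    private
      words : ∀ i → Word (t i)
      words i = word (size (t i)) (t i) ℕ.≤-refl

      letters : ℕ → List Term
      letters i = Word.head (words i) ∷ Word.tail (words i)

      open Blocks (λ i → length (Word.tail (words i)))

    atom : ℕ → Term
    atom n = lookup (letters (proj₁ (locate n))) (proj₂ (locate n))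

    atom-Atom : ∀ n → Atom (atom n)
    atom-Atom n = All.lookup (Word.atoms (words (proj₁ (locate n)))) (∈-lookup (proj₂ (locate n)))

    atomise : ΣLO ℕ _<_ (λ i → ⟦ t i ⟧) ≅ ΣLO ℕ _<_ (λ n → ⟦ atom n ⟧)
    atomise = ≅-trans (ΣLO-congʳ word≅) (flatten (λ i k → ⟦ lookup (letters i) k ⟧))
      where
      word≅ : ∀ i → ⟦ t i ⟧ ≅ ΣLO (Fin (length (letters i))) Fin._<_ (λ k → ⟦ lookup (letters i) k ⟧)
      word≅ i = ≅-trans (Word.≅word (words i)) (listLO≅ΣLO-lookup _ _)

  ones-SeqNF : SeqNF (infSeq (λ _ → one))
  ones-SeqNF = record
    { entriesNF = λ { _ _ refl → nf-fin one-finite }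
    ; noPτP = λ { _ _ _ _ refl refl refl (_ , _ , one≈ , _) → one≉Q one≈ }
    ; noPP = λ { _ _ _ refl refl ((_ , _ , one≈) , _) → one≉Q one≈ }
    ; finite = λ { _ _ refl _ → inj₂ (tt , λ _ _ → one , refl , ≈-refl) } }

  then-ones : Term → ℕ → Term
  then-ones T zero = T
  then-ones T (suc _) = one

  then-ones-SeqNF : ∀ {T} → NF T → Infinite T → SeqNF (infSeq (then-ones T))
  then-ones-SeqNF {T} nf infinite = record
    { entriesNF = λ { zero _ refl → nf ; (suc _) _ refl → nf-fin one-finite }
    ; noPτP = λ { zero _ _ _ refl refl refl (_ , _ , _ , one≈ , _) → one≉Q one≈
                ; (suc _) _ _ _ refl refl refl (_ , _ , one≈ , _) → one≉Q one≈ }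
    ; noPP = λ { zero _ _ refl refl ((_ , _ , T≈) , T≈one) → one≉Q (≈-trans (≈-sym T≈one) T≈)
               ; (suc _) _ _ refl refl ((_ , _ , one≈) , _) → one≉Q one≈ }
    ; finite = λ { zero _ refl fin → ⊥-elim (infinite fin)
                 ; (suc _) _ refl _ → inj₂ (tt , λ { zero () ; (suc _) _ → one , refl , ≈-refl }) } }

  single-SeqNF : ∀ {T} → NF T → Infinite T → SeqNF (finSeq 1 (λ _ → T))
  single-SeqNF nf infinite = record
    { entriesNF = λ { zero _ refl → nf }
    ; noPτP = λ { zero _ _ _ _ () _ }
    ; noPP = λ { zero _ _ _ () }
    ; finite = λ { zero _ refl fin → ⊥-elim (infinite fin) } }

  concatenations-SeqNF : (B : ℕ → Term) → (∀ i → NF (B i)) → (∀ i → Infinite (B i)) →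
                         (∀ i → IsCat (B i)) → SeqNF (infSeq B)
  concatenations-SeqNF B nf infinite cat = record
    { entriesNF = λ { i _ refl → nf i }
    ; noPτP = λ { i _ _ _ refl refl refl (_ , _ , B≈ , _) → ¬Q i B≈ }
    ; noPP = λ { i _ _ refl refl ((_ , _ , B≈) , _) → ¬Q i B≈ }
    ; finite = λ { i _ refl fin → ⊥-elim (infinite i fin) } }
    where
    ¬Q : ∀ i {t ts} → ¬ B i ≈ₜ Q t ts
    ¬Q i B≈ with cat i
    ... | _ , _ , e = ⌢≉Q (subst (_≈ₜ _) e B≈)

  module AtomStream (a : ℕ → Term) (a-Atom : ∀ n → Atom (a n)) where
    private
      F : ℕ → LO
      F n = ⟦ a n ⟧

    NormalSequence : Set
    NormalSequence = Σ Seq λ S → SeqNF S × (seqLO S ≅ ΣLO ℕ _<_ F)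

    no-Q : (∀ n → a n ≡ one) → NormalSequence
    no-Q a≡one = infSeq (λ _ → one) , ones-SeqNF , ΣLO-congʳ (λ n → ≡⇒≅ (cong ⟦_⟧ (sym (a≡one n))))

    last-Q : ∀ c → HasQ (range a 0 c) → (∀ n → c < n → a n ≡ one) → NormalSequence
    last-Q c has ones = infSeq (then-ones T.term) , then-ones-SeqNF T.nf T.infinite , ≅-sym (begin
      ΣLO ℕ _<_ F                                                   ≅⟨ ΣLO-ℕ-split F c ⟩
      sumLO (blockLO F 0 c) (ΣLO ℕ _<_ (λ n → F (suc c + n)))       ≅⟨ sumLO-cong (blockLO≅range a 0 c) tail≅ ⟩
      sumLO (listLO (range a 0 c)) (ΣLO ℕ _<_ (λ _ → ⟦ one ⟧))     ≅⟨ sumLO-cong T.≅term ≅-refl ⟩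
      sumLO ⟦ T.term ⟧ (ΣLO ℕ _<_ (λ _ → ⟦ one ⟧))                 ≅⟨ ΣLO-ℕ-suc _ ⟨
      seqLO (infSeq (then-ones T.term))                             ∎)
      where
      module T = Concatenation (concatenation (range-All a-Atom 0 c) has)
      tail≅ : ΣLO ℕ _<_ (λ n → F (suc c + n)) ≅ ΣLO ℕ _<_ (λ _ → ⟦ one ⟧)
      tail≅ = ΣLO-congʳ (λ n → ≡⇒≅ (cong ⟦_⟧ (ones (suc c + n) (s≤s (ℕ.m≤m+n c n)))))

    eventually-constant : ∀ c {t ts} → a c ≡ Q t ts → (∀ n → c ≤ n → a n ≈ₜ a c) → NormalSequence
    eventually-constant c {t} {ts} a≡Q constant = finSeq 1 (λ _ → T.term) , single-SeqNF T.nf T.infinite , (begin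
      ΣLO (Fin 1) Fin._<_ (λ _ → ⟦ T.term ⟧)                        ≅⟨ ΣLO-Fin1 _ ⟩
      ⟦ T.term ⟧                                                    ≅⟨ T.≅term ⟨
      listLO (range a 0 c ++ [ a c ])                               ≅⟨ listLO-++ (range a 0 c) _ ⟩
      sumLO (listLO (range a 0 c)) (sumLO ⟦ a c ⟧ emptyLO)           ≅⟨ sumLO-cong (blockLO≅range a 0 c) last≅ ⟨
      sumLO (blockLO F 0 c) (ΣLO ℕ _<_ (λ n → F (suc c + n)))       ≅⟨ ΣLO-ℕ-split F c ⟨
      ΣLO ℕ _<_ F                                                   ∎)
      where
      module T = Concatenation (concatenation (++⁺ (range-All a-Atom 0 c) (a-Atom c ∷ []))
                                              (++⁺ʳ (range a 0 c) (here (t , ts , a≡Q))))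
      last≅ : ΣLO ℕ _<_ (λ n → F (suc c + n)) ≅ sumLO ⟦ a c ⟧ emptyLO
      last≅ = begin
        ΣLO ℕ _<_ (λ n → F (suc c + n))
          ≅⟨ ΣLO-congʳ (λ n → ⟦⟧-resp-≈ (subst (a (suc c + n) ≈ₜ_) a≡Q (constant _ (c≤ n)))) ⟩
        ΣLO ℕ _<_ (λ _ → ⟦ Q t ts ⟧)      ≅⟨ Q-ω t ts ⟩
        ⟦ Q t ts ⟧                        ≡⟨ cong ⟦_⟧ (sym a≡Q) ⟩
        ⟦ a c ⟧                           ≅⟨ sumLO-identityʳ _ ⟨
        sumLO ⟦ a c ⟧ emptyLO             ∎
        where
        c≤ : ∀ n → c ≤ suc c + n
        c≤ n = ℕ.≤-trans (ℕ.m≤m+n c n) (ℕ.n≤1+n _)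

    -- Cut the stream into blocks each of which concatenates to an infinite non-shuffle term:
    -- from a 1 up to the next shuffle, or from a shuffle P over its run of copies of P to the next atom.
    module InfinitelyManyQ (Q-after : ∀ c → Σ ℕ λ n → c ≤ n × IsQ (a n))
                           (¬constant : ¬ Σ ℕ λ c → IsQ (a c) × (∀ n → c ≤ n → a n ≈ₜ a c)) where

      record Block (c : ℕ) : Set where
        field
          width    : ℕ
          term     : Term
          isCat    : IsCat term
          nf       : NF term
          infinite : Infinite term
          ≅term    : blockLO F c width ≅ ⟦ term ⟧

      block-one : ∀ c → a c ≡ one → Block c
      block-one c a≡one = record
        { width = w ; term = T.term ; nf = T.nf ; infinite = T.infinite
        ; isCat = T.cat-if-one (trans (proj₂ (range-head a c w)) (cong (_∷ proj₁ (range-head a c w)) a≡one))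
        ; ≅term = ≅-trans (blockLO≅range a c w) T.≅term }
        where
        q = proj₁ (Q-after c)
        c≤q = proj₁ (proj₂ (Q-after c))
        w = q ∸ c
        has : HasQ (range a c w)
        has = range-Any c ℕ.≤-refl
                (subst (λ k → IsQ (a k)) (sym (ℕ.m+[n∸m]≡n c≤q)) (proj₂ (proj₂ (Q-after c))))
        module T = Concatenation (concatenation (range-All a-Atom c w) has)

      copies≅Q : ∀ {t ts} s l → (∀ m → s ≤ m → m ≤ s + l → a m ≈ₜ Q t ts) → blockLO F s l ≅ ⟦ Q t ts ⟧
      copies≅Q s zero copies = ≅-trans (blockLO-zero F s) (⟦⟧-resp-≈ (copies s ℕ.≤-refl (ℕ.m≤m+n s 0)))
      copies≅Q {t} {ts} s (suc l) copies = begin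
        blockLO F s (suc l)                          ≅⟨ blockLO-suc F s l ⟩
        sumLO (F s) (blockLO F (suc s) l)
          ≅⟨ sumLO-cong (⟦⟧-resp-≈ (copies s ℕ.≤-refl (ℕ.m≤m+n s _))) (copies≅Q (suc s) l copies') ⟩
        sumLO ⟦ Q t ts ⟧ ⟦ Q t ts ⟧                  ≅⟨ Q-idem t ts ⟩
        ⟦ Q t ts ⟧                                   ∎
        where
        copies' : ∀ m → suc s ≤ m → m ≤ suc s + l → a m ≈ₜ Q t ts
        copies' m s<m m≤ = copies m (ℕ.≤-trans (ℕ.n≤1+n s) s<m) (subst (m ≤_) (sym (ℕ.+-suc s l)) m≤)

      record Run (c : ℕ) : Set where
        field
          last   : ℕ
          stays  : ∀ m → c ≤ m → m ≤ c + last → a m ≈ₜ a c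
          leaves : ¬ a (c + suc last) ≈ₜ a c

      run : ∀ c → IsQ (a c) → Run c
      run c isQ = record { last = l ; stays = stays ; leaves = subst (λ n → ¬ a n ≈ₜ a c) (sym c+sl≡i) ai≉ac }
        where
        Leaves : ℕ → Set
        Leaves m = c < m × ¬ a m ≈ₜ a c
        leaves-somewhere : Σ ℕ Leaves
        leaves-somewhere with em {P = Σ ℕ Leaves}
        ... | yes leaves = leaves
        ... | no ¬leaves = ⊥-elim (¬constant (c , isQ , stays-forever))
          where
          stays-forever : ∀ n → c ≤ n → a n ≈ₜ a c
          stays-forever n c≤n with em {P = a n ≈ₜ a c} | ℕ.m≤n⇒m<n∨m≡n c≤n
          ... | yes an≈ | _ = an≈
          ... | no an≉ | inj₁ c<n = ⊥-elim (¬leaves (n , c<n , an≉))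
          ... | no an≉ | inj₂ refl = ⊥-elim (an≉ ≈-refl)
        first = least (λ m → em {P = Leaves m}) (proj₂ leaves-somewhere)
        i = proj₁ first
        c<i = proj₁ (proj₁ (proj₂ first))
        ai≉ac = proj₂ (proj₁ (proj₂ first))
        l = i ∸ suc c
        c+sl≡i : c + suc l ≡ i
        c+sl≡i = trans (ℕ.+-suc c l) (ℕ.m+[n∸m]≡n c<i)
        stays : ∀ m → c ≤ m → m ≤ c + l → a m ≈ₜ a c
        stays m c≤m m≤ with em {P = a m ≈ₜ a c} | ℕ.m≤n⇒m<n∨m≡n c≤m
        ... | yes am≈ | _ = am≈
        ... | no am≉ | inj₂ refl = ⊥-elim (am≉ ≈-refl)
        ... | no am≉ | inj₁ c<m = ⊥-elim (proj₂ (proj₂ first) m m<i (c<m , am≉))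
          where m<i = subst (m <_) c+sl≡i (ℕ.≤-<-trans m≤ (ℕ.+-monoʳ-< c (ℕ.n<1+n l)))

      block-Q : ∀ c {t ts} → a c ≡ Q t ts → Block c
      block-Q c {t} {ts} a≡Q = record
        { width = suc R.last ; term = catL (a c) [ a i ] ; isCat = a c , a i , refl
        ; nf = NF-catL (a-Atom c ∷ a-Atom i ∷ []) (pair-¬BadFactors (λ ac≈ai → R.leaves (≈-sym ac≈ai)))
        ; infinite = HasQ⇒infinite {t = [ a i ]} (here (t , ts , a≡Q))
        ; ≅term = ≅-trans (blockLO-snoc F c R.last) (sumLO-cong run≅ac ≅-refl) }
        where
        module R = Run (run c (t , ts , a≡Q))
        i = c + suc R.last
        run≅ac : blockLO F c R.last ≅ ⟦ a c ⟧
        run≅ac = subst (λ P → blockLO F c R.last ≅ ⟦ P ⟧) (sym a≡Q)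
                       (copies≅Q c R.last (λ m c≤m m≤ → subst (a m ≈ₜ_) a≡Q (R.stays m c≤m m≤)))

      block : ∀ c → Block c
      block c with a-Atom c
      ... | _ , inj₁ a≡one = block-one c a≡one
      ... | _ , inj₂ (_ , _ , a≡Q) = block-Q c a≡Q

      start : ℕ → ℕ
      start zero = 0
      start (suc j) = start j + suc (Block.width (block (start j)))

      open Blocks (λ j → Block.width (block (start j)))

      offset≡start : ∀ j → offset j ≡ start j
      offset≡start zero = refl
      offset≡start (suc j) = cong (_+ suc (Block.width (block (start j)))) (offset≡start j)

      normal-sequence : NormalSequence
      normal-sequence = infSeq B , concatenations-SeqNF B (λ j → Block.nf (block (start j)))
                                     (λ j → Block.infinite (block (start j))) (λ j → Block.isCat (block (start j)))
                      , ≅-sym (≅-trans (regroup F) (ΣLO-congʳ block≅))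
        where
        B : ℕ → Term
        B j = Block.term (block (start j))
        block≅ : ∀ j → blockLO F (offset j) (Block.width (block (start j))) ≅ ⟦ B j ⟧
        block≅ j = subst (λ s → blockLO F s (Block.width (block (start j))) ≅ ⟦ B j ⟧) (sym (offset≡start j))
                         (Block.≅term (block (start j)))

    finitely-many-Q : ∀ c → (∀ n → c ≤ n → ¬ IsQ (a n)) → NormalSequence
    finitely-many-Q c ¬Q-after with em {P = Σ ℕ λ n → n < c × IsQ (a n)}
    ... | no ¬Q-before = no-Q λ n → Atom-¬IsQ⇒one (a-Atom n) (¬Q n)
      where
      ¬Q : ∀ n → ¬ IsQ (a n)
      ¬Q n with ℕ.<-≤-connex n c
      ... | inj₁ n<c = λ q → ¬Q-before (n , n<c , q)
      ... | inj₂ c≤n = ¬Q-after n c≤n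
    finitely-many-Q (suc c) ¬Q-after | yes (n₀ , s≤s n₀≤c , q) =
      last-Q c (range-Any 0 n₀≤c q) (λ n c<n → Atom-¬IsQ⇒one (a-Atom n) (¬Q-after n c<n))

    infinitely-many-Q : (∀ c → Σ ℕ λ n → c ≤ n × IsQ (a n)) → NormalSequence
    infinitely-many-Q Q-after with em {P = Σ ℕ λ c → IsQ (a c) × (∀ n → c ≤ n → a n ≈ₜ a c)}
    ... | yes (c , (_ , _ , a≡Q) , constant) = eventually-constant c a≡Q constant
    ... | no ¬constant = InfinitelyManyQ.normal-sequence Q-after ¬constant

    normal-sequence : NormalSequence
    normal-sequence with em {P = Σ ℕ λ c → ∀ n → c ≤ n → ¬ IsQ (a n)}
    ... | yes (c , ¬Q-after) = finitely-many-Q c ¬Q-after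
    ... | no ¬finitely = infinitely-many-Q Q-after
      where
      Q-after : ∀ c → Σ ℕ λ n → c ≤ n × IsQ (a n)
      Q-after c with em {P = Σ ℕ λ n → c ≤ n × IsQ (a n)}
      ... | yes q = q
      ... | no ¬q = ⊥-elim (¬finitely (c , λ n c≤n q → ¬q (n , c≤n , q)))

mainTheorem6 : (∀ {ℓ} → ExcludedMiddle ℓ) →
               (Qs : (n : ℕ) → DenseColoured (suc n)) →
               (t : ℕ → Term) →
               Σ Seq λ S → Semantics.SeqNF Qs S ×
                 (Semantics.seqLO Qs S ≅ Semantics.seqLO Qs (infSeq t))
mainTheorem6 em Qs t =
  let S , nf , S≅atoms = AtomStream.normal-sequence atom atom-Atom in
  S , nf , ≅-trans S≅atoms (≅-sym atomise)
  where
  open NormalSequences Qs em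
  open Atomise t
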